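{- If $n$ is sufficiently large, then $$\sum_{c=2}^{\lfloor (n-1)/2\rfloor}n\binom{n-1}{c}(2^c-1)^{n-c-1}+\sum_{c=\lfloor (n-1)/2\rfloor+1}^{n-2}n\binom{n-1}{c}(2^{n-c-1}-1)^c$$ is a $\left(1+\frac{1}{(3/2)^{n/3}}\right)$-approximation of the number of labeled split graphs on vertex set $\{1,\dots,n\}$ whose questioning set $Q$ satisfies $|Q|=1$.
   Context: A split graph is a graph whose vertex set can be partitioned into a clique and an independent set (parts may be empty); such an ordered pair (clique, independent set) is a split partition. The questioning set $Q$ of a split graph is the set of vertices $v$ for which some split partition places $v$ in the clique and some split partition places $v$ in the independent set. For $\delta>0$, a number $A$ is a $(1+\delta)$-approximation of $B$ if $B\le A\le B(1+\delta)$. -}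

module Defs where

open import Data.Nat using (ℕ; zero; suc; _+_; _*_; _∸_; _^_; _≤_)
open import Data.Nat.DivMod using (_/_)
open import Data.Nat.Combinatorics using (_C_)
open import Data.List using (List; map; upTo; length)
open import Data.Nat.ListAction using (sum)
open import Data.Bool using (Bool; true; false)
open import Data.Fin using (Fin)
open import Data.Fin.Subset using (Subset; _∈_; _∉_)
open import Data.Vec using (Vec; lookup)
open import Data.Product using (_×_; ∃)
open import Relation.Nullary using (¬_)
open import Relation.Binary.PropositionalEquality using (_≡_; _≢_)

AdjMatrix : ℕ → Set
AdjMatrix n = Vec (Vec Bool n) n

Adj : ∀ {n} → AdjMatrix n → Fin n → Fin n → Set
Adj M i j = lookup (lookup M i) j ≡ true

IsGraph : ∀ {n} → AdjMatrix n → Set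
IsGraph {n} M = (∀ (i : Fin n) → lookup (lookup M i) i ≡ false)
              × (∀ (i j : Fin n) → lookup (lookup M i) j ≡ lookup (lookup M j) i)

IsSplitPartition : ∀ {n} → AdjMatrix n → Subset n → Set
IsSplitPartition {n} M K =
    (∀ (i j : Fin n) → i ≢ j → i ∈ K → j ∈ K → Adj M i j)
  × (∀ (i j : Fin n) → i ∉ K → j ∉ K → ¬ Adj M i j)

IsSplit : ∀ {n} → AdjMatrix n → Set
IsSplit M = ∃ λ K → IsSplitPartition M K

InQ : ∀ {n} → AdjMatrix n → Fin n → Set
InQ M v = (∃ λ K → IsSplitPartition M K × v ∈ K)
        × (∃ λ K → IsSplitPartition M K × v ∉ K)

QSizeOne : ∀ {n} → AdjMatrix n → Set
QSizeOne {n} M = ∃ λ (v : Fin n) → InQ M v × (∀ (w : Fin n) → InQ M w → w ≡ v)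

IsSplitQ1 : ∀ {n} → AdjMatrix n → Set
IsSplitQ1 M = IsGraph M × IsSplit M × QSizeOne M

-- the list [a, a+1, ..., b]  (empty if b < a)
range : ℕ → ℕ → List ℕ
range a b = map (a +_) (upTo (suc b ∸ a))

sumRange : ℕ → ℕ → (ℕ → ℕ) → ℕ
sumRange a b f = sum (map f (range a b))

approxSum : ℕ → ℕ
approxSum n =
    sumRange 2 ((n ∸ 1) / 2)
      (λ c → n * ((n ∸ 1) C c) * ((2 ^ c ∸ 1) ^ (n ∸ c ∸ 1)))
  + sumRange (suc ((n ∸ 1) / 2)) (n ∸ 2)
      (λ c → n * ((n ∸ 1) C c) * ((2 ^ (n ∸ c ∸ 1) ∸ 1) ^ c))

-- A is a (1 + 1/(3/2)^(n/3))-approximation of B: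
--   B ≤ A ≤ B (1 + (2/3)^(n/3))
-- equivalently (all quantities nonnegative, cube both sides):
--   B ≤ A  and  (A - B)^3 * 3^n ≤ B^3 * 2^n
IsApprox : ℕ → ℕ → ℕ → Set
IsApprox n A B = B ≤ A × (A ∸ B) ^ 3 * 3 ^ n ≤ B ^ 3 * 2 ^ n

-- A split graph whose questioning set is {v} is determined by v, its neighbourhood X and the
-- edges between X and I, the complement of X ∪ {v}: K = X ∪ {v} is a clique and I is independent.
-- Conversely such data give a graph with Q = {v} iff every vertex of I has a non-neighbour in X
-- and every vertex of X has a neighbour in I.  For |X| = c ≤ (n − 1)/2 we drop the second
-- condition, leaving (2^c − 1)^(n−c−1) choices, and otherwise the first, leaving
-- (2^(n−c−1) − 1)^c; summed over v and X this is the approximating sum A, an upper bound for the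
-- exact count B.  Choices violating the dropped condition fix a whole column of the encoding, so
-- there are at most c·(2^(c−1))^(n−c−1) (resp. (n−c−1)·(2^(n−c−2))^c) of them; their total E
-- satisfies E·(3^k + 2^k) ≤ A·2^k for k = ⌊n/3⌋ + 1, which turns B ≤ A ≤ B + E into
-- (A − B)^3·3^n ≤ B^3·2^n.

module Submission where

open import Defs
open import Data.Bool using (Bool; _∧_; _∨_; false; if_then_else_; not; true)
open import Data.Bool.Properties using (T-≡; not-involutive; ¬-not; ∧-comm; ∧-conicalʳ; ∧-conicalˡ; ∧-zeroʳ; ∨-comm; ∨-conicalˡ; ∨-identityʳ; ∨-zeroʳ)
open import Data.Empty using (⊥; ⊥-elim)
open import Data.Fin using (Fin; _≟_; suc; zero)
open import Data.Fin.Properties using (any?)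
open import Data.Fin.Subset using (Subset) renaming (_∈_ to _∈ₛ_; _∉_ to _∉ₛ_; ⊥ to ∅)
open import Data.Fin.Subset.Properties using (_∈?_)
open import Data.List using (List; []; _++_; _∷_; allFin; applyUpTo; concatMap; filterᵇ; length; map)
open import Data.List.Membership.Propositional using (_∈_)
open import Data.List.Membership.Propositional.Properties using (∈-++⁺ʳ; ∈-++⁺ˡ; ∈-++⁻; ∈-allFin; ∈-filter⁺; ∈-filter⁻; ∈-map⁺; ∈-map⁻; ∈-∃++)
open import Data.List.Properties using (filter-++; length-++; length-map; length-tabulate; map-++; map-∘)
open import Data.List.Relation.Binary.Disjoint.Propositional using (Disjoint)
open import Data.List.Relation.Unary.All using (All; []; _∷_)
open import Data.List.Relation.Unary.Any using (here; there)
open import Data.List.Relation.Unary.Unique.Propositional using (Unique; []; _∷_)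
open import Data.List.Relation.Unary.Unique.Propositional.Properties using (allFin⁺)
open import Data.Nat using (>-nonZero; NonZero; _*_; _+_; _<?_; _<_; _^_; _∸_; _≤?_; _≤_; _≤ᵇ_; suc; s≤s; zero; z≤n; ℕ)
open import Data.Nat.Combinatorics using (_C_; k>n⇒nCk≡0; nCk+nC[k+1]≡[n+1]C[k+1])
open import Data.Nat.DivMod using (_%_; _/_; m%n<n; m/n*n≤m; m/n≡1+[m∸n]/n; m≡m%n+[m/n]*n)
open import Data.Nat.ListAction using (sum)
open import Data.Nat.ListAction.Properties using (sum-++)
open import Data.Nat.Properties hiding (_≟_)
open import Data.Nat.Tactic.RingSolver using (solve-∀)
open import Data.Product using (_,_; _×_; proj₁; proj₂; ∃)
open import Data.Sum using (_⊎_; inj₁; inj₂)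
open import Data.Vec using (Vec; []; _∷_; lookup; tabulate)
open import Data.Vec.Properties using ([]=⇒lookup; lookup-replicate; lookup⇒[]=; lookup∘tabulate; tabulate-cong; tabulate∘lookup; ∷-injectiveʳ; ∷-injectiveˡ)
open import Function using (Equivalence; _⇔_; _∘_)
open import Relation.Binary.PropositionalEquality
open import Relation.Nullary using (does; no; yes)
open import Relation.Nullary.Decidable using (T?; _×-dec_; dec-false; dec-true)
open import Algebra.Properties.CommutativeSemigroup +-commutativeSemigroup using (interchange)
import Data.List.Relation.Unary.All as All
import Data.List.Relation.Unary.Unique.Propositional.Properties as Unique
import Data.Bool.Properties as Bool

private variable
  A B : Set
  n : ℕ

length-concatMap : (f : A → List B) (xs : List A) →
  length (concatMap f xs) ≡ sum (map (length ∘ f) xs)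
length-concatMap f [] = refl
length-concatMap f (x ∷ xs) = trans (length-++ (f x)) (cong (length (f x) +_) (length-concatMap f xs))

∈-concatMap⁺′ : ∀ {f : A → List B} {x y xs} → x ∈ xs → y ∈ f x → y ∈ concatMap f xs
∈-concatMap⁺′ (here refl) q = ∈-++⁺ˡ q
∈-concatMap⁺′ {f = f} {xs = z ∷ _} (there p) q = ∈-++⁺ʳ (f z) (∈-concatMap⁺′ p q)

∈-concatMap⁻′ : ∀ {f : A → List B} {y} xs → y ∈ concatMap f xs → ∃ λ x → x ∈ xs × y ∈ f x
∈-concatMap⁻′ {f = f} (x ∷ xs) p with ∈-++⁻ (f x) p
... | inj₁ q = x , here refl , q
... | inj₂ q = let z , z∈xs , q′ = ∈-concatMap⁻′ xs q in z , there z∈xs , q′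

∈-filterᵇ⁺ : ∀ {p : A → Bool} {x xs} → x ∈ xs → p x ≡ true → x ∈ filterᵇ p xs
∈-filterᵇ⁺ {p = p} x∈xs px = ∈-filter⁺ (T? ∘ p) x∈xs (Equivalence.from T-≡ px)

∈-filterᵇ⁻ : ∀ {p : A → Bool} {x} xs → x ∈ filterᵇ p xs → x ∈ xs × p x ≡ true
∈-filterᵇ⁻ {p = p} xs x∈ = let x∈xs , px = ∈-filter⁻ (T? ∘ p) {xs = xs} x∈ in x∈xs , Equivalence.to T-≡ px

unique-filterᵇ : ∀ {p : A → Bool} {xs} → Unique xs → Unique (filterᵇ p xs)
unique-filterᵇ {p = p} = Unique.filter⁺ (T? ∘ p)

unique-map : ∀ {f : A → B} {xs} → (∀ {x y} → x ∈ xs → y ∈ xs → f x ≡ f y → x ≡ y) →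
  Unique xs → Unique (map f xs)
unique-map inj [] = []
unique-map {f = f} inj (x∉xs ∷ u) =
  All.tabulate (λ q fx≡ → let w , w∈ , fw = ∈-map⁻ f q in
    All.lookup x∉xs w∈ (inj (here refl) (there w∈) (trans fx≡ fw)))
  ∷ unique-map (λ p q → inj (there p) (there q)) u

unique-concatMap : ∀ {f : A → List B} {xs} → Unique xs → (∀ x → Unique (f x)) →
  (∀ {x x′ y} → y ∈ f x → y ∈ f x′ → x ≡ x′) → Unique (concatMap f xs)
unique-concatMap [] uf disj = []
unique-concatMap {xs = x ∷ xs} (x∉xs ∷ u) uf disj =
  Unique.++⁺ (uf x) (unique-concatMap u uf disj)
    (λ (p , q) → let w , w∈ , q′ = ∈-concatMap⁻′ xs q in All.lookup x∉xs w∈ (disj p q′))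

length-filterᵇ-partition : (p : A → Bool) (xs : List A) →
  length (filterᵇ (not ∘ p) xs) + length (filterᵇ p xs) ≡ length xs
length-filterᵇ-partition p [] = refl
length-filterᵇ-partition p (x ∷ xs) with p x
... | true = trans (+-suc _ _) (cong suc (length-filterᵇ-partition p xs))
... | false = cong suc (length-filterᵇ-partition p xs)

Unique-⊆⇒length≤ : ∀ {xs ys : List A} → Unique xs → (∀ {z} → z ∈ xs → z ∈ ys) → length xs ≤ length ys
Unique-⊆⇒length≤ {xs = []} u sub = z≤n
Unique-⊆⇒length≤ {xs = x ∷ xs} (x∉xs ∷ u) sub with ∈-∃++ (sub (here refl))
... | ys₁ , ys₂ , refl = begin
    suc (length xs)          ≤⟨ s≤s (Unique-⊆⇒length≤ u sub′) ⟩
    suc (length (ys₁ ++ ys₂)) ≡⟨ cong suc (length-++ ys₁) ⟩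
    suc (length ys₁ + length ys₂) ≡⟨ +-suc _ _ ⟨
    length ys₁ + suc (length ys₂) ≡⟨ length-++ ys₁ ⟨
    length (ys₁ ++ x ∷ ys₂)  ∎
  where
  open ≤-Reasoning
  sub′ : ∀ {z} → z ∈ xs → z ∈ ys₁ ++ ys₂
  sub′ {z} q with ∈-++⁻ ys₁ (sub (there q))
  ... | inj₁ r = ∈-++⁺ˡ r
  ... | inj₂ (here refl) = ⊥-elim (All.lookup x∉xs q refl)
  ... | inj₂ (there r) = ∈-++⁺ʳ ys₁ r

Unique-singleton : ∀ {ys : List A} {t} → Unique ys → t ∈ ys → (∀ {w} → w ∈ ys → w ≡ t) → length ys ≡ 1
Unique-singleton {ys = _ ∷ []} _ _ _ = refl
Unique-singleton {ys = _ ∷ _ ∷ _} ((y≢y′ ∷ _) ∷ _) _ all≡t =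
  ⊥-elim (y≢y′ (trans (all≡t (here refl)) (sym (all≡t (there (here refl))))))

length-filterᵇ-one-failure : (p : A → Bool) {xs : List A} {t : A} → Unique xs → t ∈ xs → p t ≡ false →
  (∀ {w} → w ∈ xs → p w ≡ false → w ≡ t) → suc (length (filterᵇ p xs)) ≡ length xs
length-filterᵇ-one-failure p {xs} u t∈ pt only-t =
  trans (cong (_+ length (filterᵇ p xs)) (sym failures≡1)) (length-filterᵇ-partition p xs)
  where
  failures≡1 : length (filterᵇ (not ∘ p) xs) ≡ 1
  failures≡1 = Unique-singleton (unique-filterᵇ u) (∈-filterᵇ⁺ t∈ (cong not pt))
    (λ q → let w∈ , npw = ∈-filterᵇ⁻ xs q in only-t w∈ (trans (sym (not-involutive _)) (cong not npw)))

sum-map-+ : (f g : A → ℕ) (xs : List A) → sum (map (λ x → f x + g x) xs) ≡ sum (map f xs) + sum (map g xs)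
sum-map-+ f g [] = refl
sum-map-+ f g (x ∷ xs) rewrite sum-map-+ f g xs = interchange (f x) (g x) _ _

sum-map-mono : (f g : A → ℕ) (xs : List A) → (∀ x → x ∈ xs → f x ≤ g x) → sum (map f xs) ≤ sum (map g xs)
sum-map-mono f g [] le = z≤n
sum-map-mono f g (x ∷ xs) le = +-mono-≤ (le x (here refl)) (sum-map-mono f g xs (λ y p → le y (there p)))

sum-map-cong : (f g : A → ℕ) (xs : List A) → (∀ x → x ∈ xs → f x ≡ g x) → sum (map f xs) ≡ sum (map g xs)
sum-map-cong f g [] eq = refl
sum-map-cong f g (x ∷ xs) eq = cong₂ _+_ (eq x (here refl)) (sum-map-cong f g xs (λ y p → eq y (there p)))

sum-map-const : (k : ℕ) (xs : List A) → sum (map (λ _ → k) xs) ≡ length xs * k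
sum-map-const k [] = refl
sum-map-const k (x ∷ xs) = cong (k +_) (sum-map-const k xs)

length≤good+bad : (f : A → B) (bad : A → Bool) (xs : List A) →
  length xs ≤ length (map f (filterᵇ (not ∘ bad) xs)) + length (filterᵇ bad xs)
length≤good+bad f bad xs = ≤-reflexive (trans (sym (length-filterᵇ-partition bad xs))
  (cong (_+ length (filterᵇ bad xs)) (sym (length-map f (filterᵇ (not ∘ bad) xs)))))

filterᵇ-map : (p : B → Bool) (f : A → B) (xs : List A) →
  filterᵇ p (map f xs) ≡ map f (filterᵇ (p ∘ f) xs)
filterᵇ-map p f [] = refl
filterᵇ-map p f (x ∷ xs) with p (f x)
... | true = cong (f x ∷_) (filterᵇ-map p f xs)
... | false = filterᵇ-map p f xs

filterᵇ-const : (b : Bool) (xs : List A) → filterᵇ (λ _ → b) xs ≡ (if b then xs else [])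
filterᵇ-const true [] = refl
filterᵇ-const false [] = refl
filterᵇ-const true (x ∷ xs) = cong (x ∷_) (filterᵇ-const true xs)
filterᵇ-const false (x ∷ xs) = filterᵇ-const false xs

count : (Fin n → Bool) → ℕ
count {zero} p = 0
count {suc n} p = (if p zero then 1 else 0) + count (p ∘ suc)

sumᶠ : (Fin n → ℕ) → ℕ
sumᶠ {zero} f = 0
sumᶠ {suc n} f = f zero + sumᶠ (f ∘ suc)

productᶠ : (Fin n → ℕ) → ℕ
productᶠ {zero} f = 1
productᶠ {suc n} f = f zero * productᶠ (f ∘ suc)

sumᶠ-if : (p : Fin n → Bool) (k : ℕ) (f : Fin n → ℕ) →
  (∀ i → f i ≡ (if p i then k else 0)) → sumᶠ f ≡ count p * k
sumᶠ-if {zero} p k f eq = refl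
sumᶠ-if {suc n} p k f eq with p zero | eq zero
... | true | f0 = cong₂ _+_ f0 (sumᶠ-if (p ∘ suc) k (f ∘ suc) (eq ∘ suc))
... | false | f0 = cong₂ _+_ f0 (sumᶠ-if (p ∘ suc) k (f ∘ suc) (eq ∘ suc))

productᶠ-if : (p : Fin n → Bool) (k : ℕ) (f : Fin n → ℕ) →
  (∀ i → f i ≡ (if p i then k else 1)) → productᶠ f ≡ k ^ count p
productᶠ-if {zero} p k f eq = refl
productᶠ-if {suc n} p k f eq with p zero | eq zero
... | true | f0 = cong₂ _*_ f0 (productᶠ-if (p ∘ suc) k (f ∘ suc) (eq ∘ suc))
... | false | f0 = trans (cong₂ _*_ f0 (productᶠ-if (p ∘ suc) k (f ∘ suc) (eq ∘ suc))) (+-identityʳ _)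

count≤n : (p : Fin n → Bool) → count p ≤ n
count≤n {zero} p = z≤n
count≤n {suc n} p with p zero
... | true = s≤s (count≤n (p ∘ suc))
... | false = m≤n⇒m≤1+n (count≤n (p ∘ suc))

count>0 : (p : Fin n → Bool) (i : Fin n) → p i ≡ true → 1 ≤ count p
count>0 p zero pi rewrite pi = s≤s z≤n
count>0 p (suc i) pi = ≤-trans (count>0 (p ∘ suc) i pi) (m≤n+m _ _)

subsetsOf : (Fin n → Bool) → List (Vec Bool n)
subsetsOf {zero} p = [] ∷ []
subsetsOf {suc n} p =
  if p zero then map (true ∷_) (subsetsOf (p ∘ suc)) ++ map (false ∷_) (subsetsOf (p ∘ suc))
  else map (false ∷_) (subsetsOf (p ∘ suc))

length-subsetsOf : (p : Fin n → Bool) → length (subsetsOf p) ≡ 2 ^ count p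
length-subsetsOf {zero} p = refl
length-subsetsOf {suc n} p with p zero
... | true = begin
    length (map (true ∷_) S ++ map (false ∷_) S) ≡⟨ length-++ (map (true ∷_) S) ⟩
    length (map (true ∷_) S) + length (map (false ∷_) S) ≡⟨ cong₂ _+_ (length-map _ S) (length-map _ S) ⟩
    length S + length S ≡⟨ cong (λ m → m + m) (length-subsetsOf (p ∘ suc)) ⟩
    2 ^ count (p ∘ suc) + 2 ^ count (p ∘ suc) ≡⟨ cong (2 ^ count (p ∘ suc) +_) (+-identityʳ _) ⟨
    2 ^ suc (count (p ∘ suc)) ∎
  where
  open ≡-Reasoning
  S = subsetsOf (p ∘ suc)
... | false = trans (length-map _ (subsetsOf (p ∘ suc))) (length-subsetsOf (p ∘ suc))

unique-subsetsOf : (p : Fin n → Bool) → Unique (subsetsOf p)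
unique-subsetsOf {zero} p = [] ∷ []
unique-subsetsOf {suc n} p with p zero
... | true = Unique.++⁺ (Unique.map⁺ ∷-injectiveʳ (unique-subsetsOf (p ∘ suc)))
                        (Unique.map⁺ ∷-injectiveʳ (unique-subsetsOf (p ∘ suc))) heads-differ
  where
  heads-differ : Disjoint (map (true ∷_) (subsetsOf (p ∘ suc))) (map (false ∷_) (subsetsOf (p ∘ suc)))
  heads-differ (t∈ , f∈) with ∈-map⁻ _ t∈ | ∈-map⁻ _ f∈
  ... | _ , _ , refl | _ , _ , ()
... | false = Unique.map⁺ ∷-injectiveʳ (unique-subsetsOf (p ∘ suc))

∈-subsetsOf⁻ : (p : Fin n → Bool) {w : Vec Bool n} → w ∈ subsetsOf p → ∀ i → lookup w i ≡ true → p i ≡ true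
∈-subsetsOf⁻ {suc n} p w∈ i wi with p zero in p0
∈-subsetsOf⁻ {suc n} p w∈ i wi | true with ∈-++⁻ (map (true ∷_) (subsetsOf (p ∘ suc))) w∈
... | inj₁ q with ∈-map⁻ _ q
... | u , u∈ , refl with i
... | zero = p0
... | suc j = ∈-subsetsOf⁻ (p ∘ suc) u∈ j wi
∈-subsetsOf⁻ {suc n} p w∈ i wi | true | inj₂ q with ∈-map⁻ _ q
... | u , u∈ , refl with i
... | suc j = ∈-subsetsOf⁻ (p ∘ suc) u∈ j wi
∈-subsetsOf⁻ {suc n} p w∈ i wi | false with ∈-map⁻ _ w∈
... | u , u∈ , refl with i
... | suc j = ∈-subsetsOf⁻ (p ∘ suc) u∈ j wi

∈-subsetsOf⁺ : (p : Fin n → Bool) (w : Vec Bool n) → (∀ i → lookup w i ≡ true → p i ≡ true) → w ∈ subsetsOf p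
∈-subsetsOf⁺ {zero} p [] w⊆p = here refl
∈-subsetsOf⁺ {suc n} p (b ∷ w) w⊆p with p zero in p0
∈-subsetsOf⁺ {suc n} p (true ∷ w) w⊆p | true = ∈-++⁺ˡ (∈-map⁺ _ (∈-subsetsOf⁺ (p ∘ suc) w (w⊆p ∘ suc)))
∈-subsetsOf⁺ {suc n} p (false ∷ w) w⊆p | true =
  ∈-++⁺ʳ (map (true ∷_) (subsetsOf (p ∘ suc))) (∈-map⁺ _ (∈-subsetsOf⁺ (p ∘ suc) w (w⊆p ∘ suc)))
∈-subsetsOf⁺ {suc n} p (true ∷ w) w⊆p | false with () ← trans (sym (w⊆p zero refl)) p0
∈-subsetsOf⁺ {suc n} p (false ∷ w) w⊆p | false = ∈-map⁺ _ (∈-subsetsOf⁺ (p ∘ suc) w (w⊆p ∘ suc))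

filterᵇ-split : ∀ {n} (q : Vec Bool (suc n) → Bool) (S : List (Vec Bool n)) →
  filterᵇ q (map (true ∷_) S ++ map (false ∷_) S) ≡
  map (true ∷_) (filterᵇ (q ∘ (true ∷_)) S) ++ map (false ∷_) (filterᵇ (q ∘ (false ∷_)) S)
filterᵇ-split q S = trans (filter-++ (T? ∘ q) (map (true ∷_) S) (map (false ∷_) S))
  (cong₂ _++_ (filterᵇ-map q (true ∷_) S) (filterᵇ-map q (false ∷_) S))

-- The hypothesis on f says that f is id or not; fixing the coordinate i ∈ p halves the count.
length-subsetsOf-fixing : (f : Bool → Bool) → f true ≡ not (f false) →
  (p : Fin n → Bool) (i : Fin n) → p i ≡ true →
  length (filterᵇ (λ w → f (lookup w i)) (subsetsOf p)) ≡ 2 ^ (count p ∸ 1)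
length-subsetsOf-fixing f ft p zero pi rewrite pi = begin
    length (filterᵇ (λ w → f (lookup w zero)) (map (true ∷_) S ++ map (false ∷_) S))
      ≡⟨ cong length (filterᵇ-split _ S) ⟩
    length (map (true ∷_) (filterᵇ (λ _ → f true) S) ++ map (false ∷_) (filterᵇ (λ _ → f false) S))
      ≡⟨ cong₂ (λ ys zs → length (map (true ∷_) ys ++ map (false ∷_) zs)) (filterᵇ-const (f true) S) (filterᵇ-const (f false) S) ⟩
    length (map (true ∷_) (if f true then S else []) ++ map (false ∷_) (if f false then S else []))
      ≡⟨ cong (λ b → length (map (true ∷_) (if b then S else []) ++ map (false ∷_) (if f false then S else []))) ft ⟩
    length (map (true ∷_) (if not (f false) then S else []) ++ map (false ∷_) (if f false then S else []))
      ≡⟨ exactly-one (f false) ⟩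
    length S ≡⟨ length-subsetsOf (p ∘ suc) ⟩
    2 ^ count (p ∘ suc) ∎
  where
  open ≡-Reasoning
  S = subsetsOf (p ∘ suc)
  exactly-one : ∀ b → length (map (true ∷_) (if not b then S else []) ++ map (false ∷_) (if b then S else [])) ≡ length S
  exactly-one true = length-map _ S
  exactly-one false = trans (length-++ (map (true ∷_) S)) (trans (+-identityʳ _) (length-map _ S))
length-subsetsOf-fixing f ft p (suc i) pi with p zero
... | true = begin
    length (filterᵇ (λ w → f (lookup w (suc i))) (map (true ∷_) S ++ map (false ∷_) S))
      ≡⟨ cong length (filterᵇ-split _ S) ⟩
    length (map (true ∷_) R ++ map (false ∷_) R) ≡⟨ length-++ (map (true ∷_) R) ⟩
    length (map (true ∷_) R) + length (map (false ∷_) R) ≡⟨ cong₂ _+_ (length-map _ R) (length-map _ R) ⟩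
    length R + length R ≡⟨ cong (λ m → m + m) (length-subsetsOf-fixing f ft (p ∘ suc) i pi) ⟩
    2 ^ (c ∸ 1) + 2 ^ (c ∸ 1) ≡⟨ cong (2 ^ (c ∸ 1) +_) (+-identityʳ _) ⟨
    2 ^ suc (c ∸ 1) ≡⟨ cong (2 ^_) (m+[n∸m]≡n (count>0 (p ∘ suc) i pi)) ⟩
    2 ^ c ∎
  where
  open ≡-Reasoning
  S = subsetsOf (p ∘ suc)
  R = filterᵇ (λ w → f (lookup w i)) S
  c = count (p ∘ suc)
... | false = trans (cong length (filterᵇ-map _ (false ∷_) (subsetsOf (p ∘ suc))))
  (trans (length-map _ (filterᵇ (λ w → f (lookup w i)) (subsetsOf (p ∘ suc)))) (length-subsetsOf-fixing f ft (p ∘ suc) i pi))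

vectorsFrom : (Fin n → List A) → List (Vec A n)
vectorsFrom {zero} f = [] ∷ []
vectorsFrom {suc n} f = concatMap (λ r → map (r ∷_) (vectorsFrom (f ∘ suc))) (f zero)

length-vectorsFrom : (f : Fin n → List A) → length (vectorsFrom f) ≡ productᶠ (length ∘ f)
length-vectorsFrom {zero} f = refl
length-vectorsFrom {suc n} f = begin
  length (concatMap (λ r → map (r ∷_) R) (f zero)) ≡⟨ length-concatMap _ (f zero) ⟩
  sum (map (λ r → length (map (r ∷_) R)) (f zero)) ≡⟨ sum-map-cong _ _ (f zero) (λ r _ → length-map (r ∷_) R) ⟩
  sum (map (λ _ → length R) (f zero)) ≡⟨ sum-map-const (length R) (f zero) ⟩
  length (f zero) * length R ≡⟨ cong (length (f zero) *_) (length-vectorsFrom (f ∘ suc)) ⟩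
  length (f zero) * productᶠ (length ∘ f ∘ suc) ∎
  where
  open ≡-Reasoning
  R = vectorsFrom (f ∘ suc)

unique-vectorsFrom : (f : Fin n → List A) → (∀ i → Unique (f i)) → Unique (vectorsFrom f)
unique-vectorsFrom {zero} f u = [] ∷ []
unique-vectorsFrom {suc n} f u =
  unique-concatMap (u zero) (λ r → Unique.map⁺ ∷-injectiveʳ (unique-vectorsFrom (f ∘ suc) (u ∘ suc))) same-head
  where
  same-head : ∀ {r r′ N} → N ∈ map (r ∷_) (vectorsFrom (f ∘ suc)) → N ∈ map (r′ ∷_) (vectorsFrom (f ∘ suc)) → r ≡ r′
  same-head p q with ∈-map⁻ _ p | ∈-map⁻ _ q
  ... | _ , _ , refl | _ , _ , e = ∷-injectiveˡ e

∈-vectorsFrom⁻ : (f : Fin n → List A) {N : Vec A n} → N ∈ vectorsFrom f → ∀ i → lookup N i ∈ f i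
∈-vectorsFrom⁻ {suc n} f N∈ i with ∈-concatMap⁻′ (f zero) N∈
... | r , r∈ , q with ∈-map⁻ _ q
... | N′ , N′∈ , refl with i
... | zero = r∈
... | suc j = ∈-vectorsFrom⁻ (f ∘ suc) N′∈ j

∈-vectorsFrom⁺ : (f : Fin n → List A) (N : Vec A n) → (∀ i → lookup N i ∈ f i) → N ∈ vectorsFrom f
∈-vectorsFrom⁺ {zero} f [] _ = here refl
∈-vectorsFrom⁺ {suc n} f (r ∷ N) N∈ = ∈-concatMap⁺′ (N∈ zero) (∈-map⁺ _ (∈-vectorsFrom⁺ (f ∘ suc) N (N∈ ∘ suc)))

concatMapᶠ : (Fin n → List A) → List A
concatMapᶠ {zero} f = []
concatMapᶠ {suc n} f = f zero ++ concatMapᶠ (f ∘ suc)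

length-concatMapᶠ : (f : Fin n → List A) → length (concatMapᶠ f) ≡ sumᶠ (length ∘ f)
length-concatMapᶠ {zero} f = refl
length-concatMapᶠ {suc n} f = trans (length-++ (f zero)) (cong (length (f zero) +_) (length-concatMapᶠ (f ∘ suc)))

∈-concatMapᶠ⁺ : (f : Fin n → List A) (i : Fin n) {y : A} → y ∈ f i → y ∈ concatMapᶠ f
∈-concatMapᶠ⁺ {suc n} f zero y∈ = ∈-++⁺ˡ y∈
∈-concatMapᶠ⁺ {suc n} f (suc i) y∈ = ∈-++⁺ʳ (f zero) (∈-concatMapᶠ⁺ (f ∘ suc) i y∈)

count-not+count : (p : Fin n → Bool) → count (not ∘ p) + count p ≡ n
count-not+count {zero} p = refl
count-not+count {suc n} p with p zero
... | true = trans (+-suc _ _) (cong suc (count-not+count (p ∘ suc)))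
... | false = cong suc (count-not+count (p ∘ suc))

count≥2 : (p : Fin n → Bool) {i j : Fin n} → i ≢ j → p i ≡ true → p j ≡ true → 2 ≤ count p
count≥2 p {zero} {zero} i≢j _ _ = ⊥-elim (i≢j refl)
count≥2 p {zero} {suc j} _ pi pj rewrite pi = s≤s (count>0 (p ∘ suc) j pj)
count≥2 p {suc i} {zero} _ pi pj rewrite pj = s≤s (count>0 (p ∘ suc) i pi)
count≥2 {suc n} p {suc i} {suc j} i≢j pi pj =
  ≤-trans (count≥2 (p ∘ suc) (i≢j ∘ cong suc) pi pj) (m≤n+m _ _)

count<n : (p : Fin n → Bool) {i : Fin n} → p i ≡ false → suc (count p) ≤ n
count<n p {zero} pi rewrite pi = s≤s (count≤n (p ∘ suc))
count<n {suc n} p {suc i} pi with p zero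
... | true = s≤s (count<n (p ∘ suc) pi)
... | false = m≤n⇒m≤1+n (count<n (p ∘ suc) pi)

count≤n∸2 : (p : Fin n → Bool) {i j : Fin n} → i ≢ j → p i ≡ false → p j ≡ false → 2 + count p ≤ n
count≤n∸2 p {zero} {zero} i≢j _ _ = ⊥-elim (i≢j refl)
count≤n∸2 p {zero} {suc j} _ pi pj rewrite pi = s≤s (count<n (p ∘ suc) pj)
count≤n∸2 p {suc i} {zero} _ pi pj rewrite pj = s≤s (count<n (p ∘ suc) pi)
count≤n∸2 {suc n} p {suc i} {suc j} i≢j pi pj with p zero
... | true = s≤s (≤-trans (≤-reflexive (sym (+-suc 1 _))) (count≤n∸2 (p ∘ suc) (i≢j ∘ cong suc) pi pj))
... | false = m≤n⇒m≤1+n (count≤n∸2 (p ∘ suc) (i≢j ∘ cong suc) pi pj)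

-- Split graphs whose questioning set is a singleton

_≡ᵇ_ : Fin n → Fin n → Bool
x ≡ᵇ y = does (x ≟ y)

≡ᵇ-refl : (x : Fin n) → (x ≡ᵇ x) ≡ true
≡ᵇ-refl x = dec-true (x ≟ x) refl

≡ᵇ-≢ : {x y : Fin n} → x ≢ y → (x ≡ᵇ y) ≡ false
≡ᵇ-≢ {x = x} {y} = dec-false (x ≟ y)

≡ᵇ-sym : (x y : Fin n) → (x ≡ᵇ y) ≡ (y ≡ᵇ x)
≡ᵇ-sym x y with x ≟ y
... | yes refl = sym (≡ᵇ-refl x)
... | no x≢y = sym (≡ᵇ-≢ (x≢y ∘ sym))

true≢false : true ≢ false
true≢false ()

entry : AdjMatrix n → Fin n → Fin n → Bool
entry M x y = lookup (lookup M x) y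

vec-ext : {A : Set} {u w : Vec A n} → (∀ i → lookup u i ≡ lookup w i) → u ≡ w
vec-ext {u = u} {w} eq = trans (sym (tabulate∘lookup u)) (trans (tabulate-cong eq) (tabulate∘lookup w))

matrix-ext : {M N : AdjMatrix n} → (∀ i j → entry M i j ≡ entry N i j) → M ≡ N
matrix-ext eq = vec-ext (λ i → vec-ext (eq i))

entry-tabulate : (f : Fin n → Fin n → Bool) (x y : Fin n) → entry (tabulate (λ x → tabulate (f x))) x y ≡ f x y
entry-tabulate f x y = trans (cong (λ r → lookup r y) (lookup∘tabulate _ x)) (lookup∘tabulate (f x) y)

∉⇒lookup≡false : {x : Fin n} {K : Subset n} → x ∉ₛ K → lookup K x ≡ false
∉⇒lookup≡false {x = x} {K} x∉K with lookup K x in eq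
... | true = ⊥-elim (x∉K (lookup⇒[]= x K eq))
... | false = refl

lookup≡false⇒∉ : {x : Fin n} {K : Subset n} → lookup K x ≡ false → x ∉ₛ K
lookup≡false⇒∉ eq x∈K = true≢false (trans (sym ([]=⇒lookup x∈K)) eq)

∈-tabulate⁻ : {f : Fin n → Bool} {x : Fin n} → x ∈ₛ tabulate f → f x ≡ true
∈-tabulate⁻ {f = f} {x} x∈ = trans (sym (lookup∘tabulate f x)) ([]=⇒lookup x∈)

∈-tabulate⁺ : {f : Fin n → Bool} {x : Fin n} → f x ≡ true → x ∈ₛ tabulate f
∈-tabulate⁺ {f = f} {x} fx = lookup⇒[]= x (tabulate f) (trans (lookup∘tabulate f x) fx)

∉-tabulate⁻ : {f : Fin n → Bool} {x : Fin n} → x ∉ₛ tabulate f → f x ≡ false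
∉-tabulate⁻ {f = f} {x} x∉ = trans (sym (lookup∘tabulate f x)) (∉⇒lookup≡false x∉)

∉-tabulate⁺ : {f : Fin n → Bool} {x : Fin n} → f x ≡ false → x ∉ₛ tabulate f
∉-tabulate⁺ {f = f} {x} fx = lookup≡false⇒∉ (trans (lookup∘tabulate f x) fx)

module SplitGraph (v : Fin n) (X : Subset n) where

  inX : Fin n → Bool
  inX = lookup X

  inK : Fin n → Bool
  inK x = (x ≡ᵇ v) ∨ inX x

  inI : Fin n → Bool
  inI x = not (inK x)

  crossEdge : (Fin n → Fin n → Bool) → Fin n → Fin n → Bool
  crossEdge e x y = (inX x ∧ inI y) ∧ e x y

  edge : (Fin n → Fin n → Bool) → Fin n → Fin n → Bool
  edge e x y = not (x ≡ᵇ y) ∧ ((inK x ∧ inK y) ∨ (crossEdge e x y ∨ crossEdge e y x))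

  splitGraph : (Fin n → Fin n → Bool) → AdjMatrix n
  splitGraph e = tabulate (λ x → tabulate (edge e x))

  inK-v : inK v ≡ true
  inK-v rewrite ≡ᵇ-refl v = refl

  inX⇒inK : ∀ {x} → inX x ≡ true → inK x ≡ true
  inX⇒inK {x} Xx rewrite Xx = ∨-zeroʳ (x ≡ᵇ v)

  inK-≢v : ∀ {x} → x ≢ v → inK x ≡ inX x
  inK-≢v x≢v rewrite ≡ᵇ-≢ x≢v = refl

  ¬inK⇒¬inX : ∀ {x} → inK x ≡ false → inX x ≡ false
  ¬inK⇒¬inX {x} Kx with x ≡ᵇ v
  ... | false = Kx

  ¬inK⇒≢v : ∀ {x} → inK x ≡ false → x ≢ v
  ¬inK⇒≢v Kx refl = true≢false (trans (sym inK-v) Kx)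

  inK-separates : ∀ {x y} → inK x ≡ true → inK y ≡ false → x ≢ y
  inK-separates Kx Ky refl = true≢false (trans (sym Kx) Ky)

  splitGraph-cong : {e e′ : Fin n → Fin n → Bool} →
    (∀ {x y} → inX x ≡ true → inK y ≡ false → e x y ≡ e′ x y) → splitGraph e ≡ splitGraph e′
  splitGraph-cong {e} {e′} agree = matrix-ext (λ x y →
    trans (entry-tabulate (edge e) x y)
      (trans (cong₂ (λ a b → not (x ≡ᵇ y) ∧ ((inK x ∧ inK y) ∨ (a ∨ b))) (cross-agree x y) (cross-agree y x))
        (sym (entry-tabulate (edge e′) x y))))
    where
    cross-agree : ∀ x y → crossEdge e x y ≡ crossEdge e′ x y
    cross-agree x y with inX x in Xx | inK y in Ky
    ... | true | false = agree Xx Ky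
    ... | true | true = refl
    ... | false | _ = refl

  module _ (e : Fin n → Fin n → Bool) where

    private
      G = splitGraph e

    entry-splitGraph : ∀ x y → entry G x y ≡ edge e x y
    entry-splitGraph = entry-tabulate (edge e)

    entry-diag : ∀ x → entry G x x ≡ false
    entry-diag x rewrite entry-splitGraph x x | ≡ᵇ-refl x = refl

    entry-sym : ∀ x y → entry G x y ≡ entry G y x
    entry-sym x y rewrite entry-splitGraph x y | entry-splitGraph y x =
      cong₂ (λ d b → not d ∧ b) (≡ᵇ-sym x y)
        (cong₂ _∨_ (∧-comm (inK x) (inK y)) (∨-comm (crossEdge e x y) (crossEdge e y x)))

    entry-KK : ∀ {x y} → x ≢ y → inK x ≡ true → inK y ≡ true → entry G x y ≡ true
    entry-KK {x} {y} x≢y Kx Ky rewrite entry-splitGraph x y | ≡ᵇ-≢ x≢y | Kx | Ky = refl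

    entry-XI : ∀ {x y} → inX x ≡ true → inK y ≡ false → entry G x y ≡ e x y
    entry-XI {x} {y} Xx Ky
      rewrite entry-splitGraph x y | ≡ᵇ-≢ (inK-separates (inX⇒inK Xx) Ky) | inX⇒inK Xx | Ky | Xx
            | ¬inK⇒¬inX Ky = ∨-identityʳ (e x y)

    entry-IX : ∀ {x y} → inK x ≡ false → inX y ≡ true → entry G x y ≡ e y x
    entry-IX Kx Xy = trans (entry-sym _ _) (entry-XI Xy Kx)

    entry-II : ∀ {x y} → inK x ≡ false → inK y ≡ false → entry G x y ≡ false
    entry-II {x} {y} Kx Ky rewrite entry-splitGraph x y | Kx | Ky | ¬inK⇒¬inX Kx | ¬inK⇒¬inX Ky
      with x ≡ᵇ y
    ... | true = refl
    ... | false = refl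

    entry-vI : inX v ≡ false → ∀ {y} → inK y ≡ false → entry G v y ≡ false
    entry-vI Xv {y} Ky
      rewrite entry-splitGraph v y | ≡ᵇ-≢ (inK-separates inK-v Ky) | inK-v | Ky | Xv | ¬inK⇒¬inX Ky = refl

    entry-Iv : inX v ≡ false → ∀ {x} → inK x ≡ false → entry G x v ≡ false
    entry-Iv Xv Kx = trans (entry-sym _ _) (entry-vI Xv Kx)

not≡true⇒≡false : ∀ {b} → not b ≡ true → b ≡ false
not≡true⇒≡false {false} _ = refl

not≡false⇒≡true : ∀ {b} → not b ≡ false → b ≡ true
not≡false⇒≡true {true} _ = refl

module _ (v : Fin n) (X : Subset n) where
  open SplitGraph v X

  -- The paper's characterisation of Q = {v}: every vertex of I has a non-neighbour in X,
  -- and every vertex of X has a neighbour in I.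
  Admissible : (Fin n → Fin n → Bool) → Set
  Admissible e = inX v ≡ false
               × (∀ y → inK y ≡ false → ∃ λ x → inX x ≡ true × e x y ≡ false)
               × (∀ x → inX x ≡ true → ∃ λ y → inK y ≡ false × e x y ≡ true)

  module Partitions (e : Fin n → Fin n → Bool) (Xv : inX v ≡ false) where

    private
      G = splitGraph e

    entry-outside-X : ∀ {x y} → inX x ≡ false → inX y ≡ false → entry G x y ≡ false
    entry-outside-X {x} {y} Xx Xy with x ≟ y | x ≟ v | y ≟ v
    ... | yes refl | _ | _ = entry-diag e x
    ... | no x≢y | yes refl | yes refl = ⊥-elim (x≢y refl)
    ... | no _ | yes refl | no y≢v = entry-vI e Xv (trans (inK-≢v y≢v) Xy)
    ... | no _ | no x≢v | yes refl = entry-Iv e Xv (trans (inK-≢v x≢v) Xx)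
    ... | no _ | no x≢v | no y≢v = entry-II e (trans (inK-≢v x≢v) Xx) (trans (inK-≢v y≢v) Xy)

    K-partition : IsSplitPartition G (tabulate inK)
    K-partition = (λ i j i≢j i∈ j∈ → entry-KK e i≢j (∈-tabulate⁻ i∈) (∈-tabulate⁻ j∈))
                , (λ i j i∉ j∉ ij → true≢false (trans (sym ij) (entry-II e (∉-tabulate⁻ i∉) (∉-tabulate⁻ j∉))))

    X-partition : IsSplitPartition G X
    X-partition = (λ i j i≢j i∈ j∈ → entry-KK e i≢j (inX⇒inK ([]=⇒lookup i∈)) (inX⇒inK ([]=⇒lookup j∈)))
                , (λ i j i∉ j∉ ij → true≢false (trans (sym ij) (entry-outside-X (∉⇒lookup≡false i∉) (∉⇒lookup≡false j∉))))

    module _ (x : Fin n) (Xx : inX x ≡ true) (isolated : ∀ y → inK y ≡ false → e x y ≡ false) where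

      K∖x : Fin n → Bool
      K∖x u = inK u ∧ not (u ≡ᵇ x)

      K∖x-partition : IsSplitPartition G (tabulate K∖x)
      K∖x-partition = (λ i j i≢j i∈ j∈ → entry-KK e i≢j (inK-of i∈) (inK-of j∈))
                    , (λ i j i∉ j∉ ij → true≢false (trans (sym ij) (indep (outside i∉) (outside j∉))))
        where
        inK-of : ∀ {u} → u ∈ₛ tabulate K∖x → inK u ≡ true
        inK-of {u} u∈ = ∧-conicalˡ (inK u) _ (∈-tabulate⁻ u∈)
        outside : ∀ {u} → u ∉ₛ tabulate K∖x → inK u ≡ false ⊎ u ≡ x
        outside {u} u∉ with inK u | u ≟ x | ∉-tabulate⁻ {f = K∖x} u∉
        ... | false | _ | _ = inj₁ refl
        ... | true | yes u≡x | _ = inj₂ u≡x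
        ... | true | no _ | ()
        indep : ∀ {i j} → inK i ≡ false ⊎ i ≡ x → inK j ≡ false ⊎ j ≡ x → entry G i j ≡ false
        indep (inj₁ Ki) (inj₁ Kj) = entry-II e Ki Kj
        indep (inj₁ Ki) (inj₂ refl) = trans (entry-IX e Ki Xx) (isolated _ Ki)
        indep (inj₂ refl) (inj₁ Kj) = trans (entry-XI e Xx Kj) (isolated _ Kj)
        indep (inj₂ refl) (inj₂ refl) = entry-diag e x

      x∉K∖x : x ∉ₛ tabulate K∖x
      x∉K∖x = ∉-tabulate⁺ (trans (cong (λ b → inK x ∧ not b) (≡ᵇ-refl x)) (∧-zeroʳ (inK x)))

    module _ (y : Fin n) (Ky : inK y ≡ false) (dominating : ∀ x → inX x ≡ true → e x y ≡ true) where

      X∪y : Fin n → Bool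
      X∪y u = inX u ∨ (u ≡ᵇ y)

      X∪y-partition : IsSplitPartition G (tabulate X∪y)
      X∪y-partition = (λ i j i≢j i∈ j∈ → clique i≢j (inside i∈) (inside j∈))
                    , (λ i j i∉ j∉ ij → true≢false (trans (sym ij) (entry-outside-X (inX-of i∉) (inX-of j∉))))
        where
        inside : ∀ {u} → u ∈ₛ tabulate X∪y → inX u ≡ true ⊎ u ≡ y
        inside {u} u∈ with inX u | u ≟ y | ∈-tabulate⁻ {f = X∪y} u∈
        ... | true | _ | _ = inj₁ refl
        ... | false | yes u≡y | _ = inj₂ u≡y
        ... | false | no _ | ()
        inX-of : ∀ {u} → u ∉ₛ tabulate X∪y → inX u ≡ false
        inX-of {u} u∉ = ∨-conicalˡ (inX u) _ (∉-tabulate⁻ u∉)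
        clique : ∀ {i j} → i ≢ j → inX i ≡ true ⊎ i ≡ y → inX j ≡ true ⊎ j ≡ y → Adj G i j
        clique i≢j (inj₁ Xi) (inj₁ Xj) = entry-KK e i≢j (inX⇒inK Xi) (inX⇒inK Xj)
        clique i≢j (inj₁ Xi) (inj₂ refl) = trans (entry-XI e Xi Ky) (dominating _ Xi)
        clique i≢j (inj₂ refl) (inj₁ Xj) = trans (entry-IX e Ky Xj) (dominating _ Xj)
        clique i≢j (inj₂ refl) (inj₂ refl) = ⊥-elim (i≢j refl)

      y∈X∪y : y ∈ₛ tabulate X∪y
      y∈X∪y = ∈-tabulate⁺ (trans (cong (inX y ∨_) (≡ᵇ-refl y)) (∨-zeroʳ (inX y)))

QIsSingleton : AdjMatrix n → Fin n → Set
QIsSingleton M v = InQ M v × (∀ w → InQ M w → w ≡ v)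

module _ (v : Fin n) (X : Subset n) (e : Fin n → Fin n → Bool) (adm : Admissible v X e) where
  open SplitGraph v X

  private
    G = splitGraph e
    Xv = proj₁ adm
    nonNeighbourIn-X = proj₁ (proj₂ adm)
    neighbourIn-I = proj₂ (proj₂ adm)
  open Partitions v X e Xv

  v∈Q : InQ G v
  v∈Q = (tabulate inK , K-partition , ∈-tabulate⁺ inK-v) , (X , X-partition , lookup≡false⇒∉ Xv)

  -- w ∈ X has a neighbour y ∈ I; a partition putting w on the independent side
  -- must put y, hence also v (not adjacent to y), into the clique, yet v ≁ y.
  X-vertex∉Q : ∀ {w} → inX w ≡ true → w ≢ v → ∀ K → IsSplitPartition G K → w ∉ₛ K → ⊥
  X-vertex∉Q {w} Xw w≢v K (clique , indep) w∉K with neighbourIn-I w Xw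
  ... | y , Ky , ewy with y ∈? K | v ∈? K
  ... | no y∉K | _ = indep w y w∉K y∉K (trans (entry-XI e Xw Ky) ewy)
  ... | yes _ | no v∉K = indep w v w∉K v∉K (entry-KK e w≢v (inX⇒inK Xw) inK-v)
  ... | yes y∈K | yes v∈K = true≢false (trans (sym (clique y v (¬inK⇒≢v Ky) y∈K v∈K)) (entry-Iv e Xv Ky))

  -- Dually, w ∈ I has a non-neighbour x ∈ X, and w cannot join the clique.
  I-vertex∉Q : ∀ {w} → inK w ≡ false → ∀ K → IsSplitPartition G K → w ∈ₛ K → ⊥
  I-vertex∉Q {w} Kw K (clique , indep) w∈K with nonNeighbourIn-X w Kw
  ... | x , Xx , exw with x ∈? K | v ∈? K
  ... | yes x∈K | _ =
    true≢false (trans (sym (clique w x (inK-separates (inX⇒inK Xx) Kw ∘ sym) w∈K x∈K)) (trans (entry-IX e Kw Xx) exw))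
  ... | no x∉K | yes v∈K = true≢false (trans (sym (clique w v (¬inK⇒≢v Kw) w∈K v∈K)) (entry-Iv e Xv Kw))
  ... | no x∉K | no v∉K = indep x v x∉K v∉K (entry-KK e x≢v (inX⇒inK Xx) inK-v)
    where
    x≢v : x ≢ v
    x≢v refl = true≢false (trans (sym Xx) Xv)

  only-v∈Q : ∀ w → InQ G w → w ≡ v
  only-v∈Q w ((K₁ , split₁ , w∈K₁) , (K₂ , split₂ , w∉K₂)) with w ≟ v
  ... | yes w≡v = w≡v
  ... | no w≢v with inX w in Xw
  ... | true = ⊥-elim (X-vertex∉Q Xw w≢v K₂ split₂ w∉K₂)
  ... | false = ⊥-elim (I-vertex∉Q (trans (inK-≢v w≢v) Xw) K₁ split₁ w∈K₁)

  row-v : lookup G v ≡ X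
  row-v = vec-ext entry-v
    where
    entry-v : ∀ y → entry G v y ≡ inX y
    entry-v y with y ≟ v
    ... | yes refl = trans (entry-diag e v) (sym Xv)
    ... | no y≢v with inX y in Xy
    ... | true = entry-KK e (y≢v ∘ sym) inK-v (inX⇒inK Xy)
    ... | false = entry-vI e Xv (trans (inK-≢v y≢v) Xy)

  splitGraph-sound : IsSplitQ1 G × QIsSingleton G v × lookup G v ≡ X
  splitGraph-sound =
    ((entry-diag e , entry-sym e) , (tabulate inK , K-partition) , v , v∈Q , only-v∈Q) , (v∈Q , only-v∈Q) , row-v

-- K₁ and K₂ are split partitions with v ∈ K₁ and v ∉ K₂; they agree off v because v is the only
-- questionable vertex.
module Reconstruction {M : AdjMatrix n} (graph : IsGraph M) {v : Fin n} (v∈Q : InQ M v)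
                      (only-v : ∀ w → InQ M w → w ≡ v) where

  X = lookup M v
  e = entry M
  open SplitGraph v X

  private
    loop = proj₁ graph
    symm = proj₂ graph
    K₁ = proj₁ (proj₁ v∈Q)
    split₁ = proj₁ (proj₂ (proj₁ v∈Q))
    v∈K₁ = proj₂ (proj₂ (proj₁ v∈Q))
    K₂ = proj₁ (proj₂ v∈Q)
    split₂ = proj₁ (proj₂ (proj₂ v∈Q))
    v∉K₂ = proj₂ (proj₂ (proj₂ v∈Q))

    Xv : inX v ≡ false
    Xv = loop v

    ∉K₁⇒∉K₂ : ∀ {u} → u ≢ v → u ∉ₛ K₁ → u ∉ₛ K₂
    ∉K₁⇒∉K₂ {u} u≢v u∉K₁ u∈K₂ = u≢v (only-v u ((K₂ , split₂ , u∈K₂) , (K₁ , split₁ , u∉K₁)))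

    inK⇒∈K₁ : ∀ {u} → inK u ≡ true → u ∈ₛ K₁
    inK⇒∈K₁ {u} Ku with u ≟ v | u ∈? K₁
    ... | yes refl | _ = v∈K₁
    ... | no _ | yes u∈K₁ = u∈K₁
    ... | no u≢v | no u∉K₁ = ⊥-elim (proj₂ split₂ v u v∉K₂ (∉K₁⇒∉K₂ u≢v u∉K₁) Ku)

    ¬inK⇒∉K₁ : ∀ {u} → inK u ≡ false → u ∉ₛ K₁
    ¬inK⇒∉K₁ {u} Ku u∈K₁ = true≢false (trans (sym (proj₁ split₁ v u (¬inK⇒≢v Ku ∘ sym) v∈K₁ u∈K₁)) (¬inK⇒¬inX Ku))

    ¬inK⇒∉K₂ : ∀ {u} → inK u ≡ false → u ∉ₛ K₂
    ¬inK⇒∉K₂ Ku = ∉K₁⇒∉K₂ (¬inK⇒≢v Ku) (¬inK⇒∉K₁ Ku)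

    entries-agree : ∀ x y → entry M x y ≡ entry (splitGraph e) x y
    entries-agree x y with x ≟ y
    ... | yes refl = trans (loop x) (sym (entry-diag e x))
    ... | no x≢y with inK x in Kx | inK y in Ky
    ... | true | true = trans (proj₁ split₁ x y x≢y (inK⇒∈K₁ Kx) (inK⇒∈K₁ Ky)) (sym (entry-KK e x≢y Kx Ky))
    ... | false | false = trans (¬-not (proj₂ split₂ x y (¬inK⇒∉K₂ Kx) (¬inK⇒∉K₂ Ky))) (sym (entry-II e Kx Ky))
    ... | true | false with x ≟ v
    ... | yes refl = trans (¬inK⇒¬inX Ky) (sym (entry-vI e Xv Ky))
    ... | no _ = sym (entry-XI e Kx Ky)
    entries-agree x y | no _ | false | true with y ≟ v
    ... | yes refl = trans (symm x v) (trans (¬inK⇒¬inX Kx) (sym (entry-Iv e Xv Kx)))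
    ... | no _ = trans (symm x y) (sym (entry-IX e Kx Ky))

  M≡splitGraph : M ≡ splitGraph e
  M≡splitGraph = matrix-ext entries-agree

  private
    open Partitions v X e Xv

    only-v-in-splitGraph : ∀ w → InQ (splitGraph e) w → w ≡ v
    only-v-in-splitGraph w w∈Q = only-v w (subst (λ N → InQ N w) (sym M≡splitGraph) w∈Q)

    -- Otherwise x would be questionable: it lies in K but not in K ∖ {x}.
    neighbourIn-I : ∀ x → inX x ≡ true → ∃ λ y → inK y ≡ false × e x y ≡ true
    neighbourIn-I x Xx with any? (λ y → (inK y Bool.≟ false) ×-dec (e x y Bool.≟ true))
    ... | yes found = found
    ... | no none = ⊥-elim (true≢false (trans (sym Xx) (subst (λ w → inX w ≡ false) (sym (only-v-in-splitGraph x x∈Q)) Xv)))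
      where
      isolated : ∀ y → inK y ≡ false → e x y ≡ false
      isolated y Ky = ¬-not (λ exy → none (y , Ky , exy))
      x∈Q : InQ (splitGraph e) x
      x∈Q = (tabulate inK , K-partition , ∈-tabulate⁺ (inX⇒inK Xx))
          , (_ , K∖x-partition x Xx isolated , x∉K∖x x Xx isolated)

    -- Otherwise y would be questionable: it lies in X ∪ {y} but not in K.
    nonNeighbourIn-X : ∀ y → inK y ≡ false → ∃ λ x → inX x ≡ true × e x y ≡ false
    nonNeighbourIn-X y Ky with any? (λ x → (inX x Bool.≟ true) ×-dec (e x y Bool.≟ false))
    ... | yes found = found
    ... | no none = ⊥-elim (¬inK⇒≢v Ky (only-v-in-splitGraph y y∈Q))
      where
      dominating : ∀ x → inX x ≡ true → e x y ≡ true
      dominating x Xx = ¬-not (λ exy → none (x , Xx , exy))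
      y∈Q : InQ (splitGraph e) y
      y∈Q = (_ , X∪y-partition y Ky dominating , y∈X∪y y Ky dominating)
          , (tabulate inK , K-partition , ∉-tabulate⁺ Ky)

  admissible : Admissible v X e
  admissible = Xv , nonNeighbourIn-X , neighbourIn-I

splitGraph-complete : (M : AdjMatrix n) → IsSplitQ1 M →
  ∃ λ v → Admissible v (lookup M v) (entry M) × M ≡ SplitGraph.splitGraph v (lookup M v) (entry M)
splitGraph-complete M (graph , _ , v , v∈Q , only-v) = v , admissible , M≡splitGraph
  where open Reconstruction {M = M} graph v∈Q only-v

-- Encoding the edges between X and I by matrices

anyᶠ : (Fin n → Bool) → Bool
anyᶠ {zero} p = false
anyᶠ {suc n} p = p zero ∨ anyᶠ (p ∘ suc)

anyᶠ-true⁻ : (p : Fin n → Bool) → anyᶠ p ≡ true → ∃ λ i → p i ≡ true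
anyᶠ-true⁻ {suc n} p any with p zero in p0
... | true = zero , p0
... | false = let i , pi = anyᶠ-true⁻ (p ∘ suc) any in suc i , pi

anyᶠ-false⁻ : (p : Fin n → Bool) → anyᶠ p ≡ false → ∀ i → p i ≡ false
anyᶠ-false⁻ {suc n} p none i with p zero in p0
anyᶠ-false⁻ {suc n} p none zero | false = p0
anyᶠ-false⁻ {suc n} p none (suc i) | false = anyᶠ-false⁻ (p ∘ suc) none i

anyᶠ-false⁺ : (p : Fin n → Bool) → (∀ i → p i ≡ false) → anyᶠ p ≡ false
anyᶠ-false⁺ {zero} p none = refl
anyᶠ-false⁺ {suc n} p none rewrite none zero = anyᶠ-false⁺ (p ∘ suc) (none ∘ suc)

anyᶠ-true⁺ : (p : Fin n → Bool) (i : Fin n) → p i ≡ true → anyᶠ p ≡ true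
anyᶠ-true⁺ p zero pi rewrite pi = refl
anyᶠ-true⁺ p (suc i) pi rewrite anyᶠ-true⁺ (p ∘ suc) i pi = ∨-zeroʳ (p zero)

if-true : ∀ {A : Set} {b} {x y : A} → b ≡ true → (if b then x else y) ≡ x
if-true refl = refl

if-false : ∀ {A : Set} {b} {x y : A} → b ≡ false → (if b then x else y) ≡ y
if-false refl = refl

restrict : (Rows Cols : Fin n → Bool) → (Fin n → Fin n → Bool) → AdjMatrix n
restrict Rows Cols f = tabulate (λ r → tabulate (λ c → Rows r ∧ (Cols c ∧ f r c)))

module RowMatrices (Rows Cols : Fin n → Bool) (ok : Vec Bool n → Bool) where

  rowChoices : Fin n → List (Vec Bool n)
  rowChoices r = if Rows r then filterᵇ ok (subsetsOf Cols) else (∅ ∷ [])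

  rowMatrices : List (AdjMatrix n)
  rowMatrices = vectorsFrom rowChoices

  length-rowMatrices : length rowMatrices ≡ length (filterᵇ ok (subsetsOf Cols)) ^ count Rows
  length-rowMatrices = trans (length-vectorsFrom rowChoices) (productᶠ-if Rows _ _ length-row)
    where
    length-row : ∀ r → length (rowChoices r) ≡ (if Rows r then length (filterᵇ ok (subsetsOf Cols)) else 1)
    length-row r with Rows r
    ... | true = refl
    ... | false = refl

  unique-rowMatrices : Unique rowMatrices
  unique-rowMatrices = unique-vectorsFrom rowChoices unique-row
    where
    unique-row : ∀ r → Unique (rowChoices r)
    unique-row r with Rows r
    ... | true = unique-filterᵇ (unique-subsetsOf Cols)
    ... | false = [] ∷ []

  module _ {N : AdjMatrix n} (N∈ : N ∈ rowMatrices) where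

    row-accepted : ∀ {r} → Rows r ≡ true → lookup N r ∈ filterᵇ ok (subsetsOf Cols)
    row-accepted {r} Rr = subst (lookup N r ∈_) (if-true Rr) (∈-vectorsFrom⁻ rowChoices N∈ r)

    ok-row : ∀ {r} → Rows r ≡ true → ok (lookup N r) ≡ true
    ok-row Rr = proj₂ (∈-filterᵇ⁻ (subsetsOf Cols) (row-accepted Rr))

    entry-outside-R : ∀ {r} → Rows r ≡ false → ∀ c → entry N r c ≡ false
    entry-outside-R {r} Rr c with ∈-vectorsFrom⁻ rowChoices N∈ r
    ... | r∈ rewrite Rr with r∈
    ... | here eq = trans (cong (λ w → lookup w c) eq) (lookup-replicate c _)

    entry-outside-C : ∀ {r c} → Cols c ≡ false → entry N r c ≡ false
    entry-outside-C {r} {c} Cc with Rows r in Rr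
    ... | false = entry-outside-R Rr c
    ... | true with entry N r c in Nrc
    ... | false = refl
    ... | true = trans (sym (∈-subsetsOf⁻ Cols (proj₁ (∈-filterᵇ⁻ (subsetsOf Cols) (row-accepted Rr))) c Nrc)) Cc

  rowMatrices-ext : ∀ {N N′} → N ∈ rowMatrices → N′ ∈ rowMatrices →
    (∀ {r c} → Rows r ≡ true → Cols c ≡ true → entry N r c ≡ entry N′ r c) → N ≡ N′
  rowMatrices-ext {N} {N′} N∈ N′∈ agree = matrix-ext entries
    where
    entries : ∀ r c → entry N r c ≡ entry N′ r c
    entries r c with Rows r in Rr | Cols c in Cc
    ... | true | true = agree Rr Cc
    ... | true | false = trans (entry-outside-C N∈ Cc) (sym (entry-outside-C N′∈ Cc))
    ... | false | _ = trans (entry-outside-R N∈ Rr c) (sym (entry-outside-R N′∈ Rr c))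

  restrict∈rowMatrices : (f : Fin n → Fin n → Bool) →
    (∀ r → Rows r ≡ true → ok (tabulate (λ c → Cols c ∧ f r c)) ≡ true) → restrict Rows Cols f ∈ rowMatrices
  restrict∈rowMatrices f ok-f = ∈-vectorsFrom⁺ rowChoices (restrict Rows Cols f) row∈
    where
    row : ∀ r → lookup (restrict Rows Cols f) r ≡ tabulate (λ c → Rows r ∧ (Cols c ∧ f r c))
    row r = lookup∘tabulate _ r
    row∈ : ∀ r → lookup (restrict Rows Cols f) r ∈ rowChoices r
    row∈ r with Rows r in Rr
    ... | true = ∈-filterᵇ⁺ (∈-subsetsOf⁺ Cols _ within-C)
      (trans (cong ok (row r)) (trans (cong (λ b → ok (tabulate (λ c → b ∧ (Cols c ∧ f r c)))) Rr) (ok-f r Rr)))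
      where
      within-C : ∀ c → lookup (lookup (restrict Rows Cols f) r) c ≡ true → Cols c ≡ true
      within-C c e = ∧-conicalˡ (Cols c) _ (∧-conicalʳ (Rows r) _ (trans (sym (entry-tabulate _ r c)) e))
    ... | false = here (trans (row r) (vec-ext (λ c → trans (lookup∘tabulate _ c)
      (trans (cong (λ b → b ∧ (Cols c ∧ f r c)) Rr) (sym (lookup-replicate c _))))))

module ColumnBounds (Rows Cols : Fin n → Bool) (ok : Vec Bool n → Bool) where

  open RowMatrices Rows Cols ok

  column-fixed : (f : Bool → Bool) → Fin n → List (AdjMatrix n)
  column-fixed f c = RowMatrices.rowMatrices Rows Cols (λ w → f (lookup w c))

  ∈-column-fixed : (f : Bool → Bool) (c : Fin n) {N : AdjMatrix n} → N ∈ rowMatrices →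
    (∀ r → Rows r ≡ true → f (entry N r c) ≡ true) → N ∈ column-fixed f c
  ∈-column-fixed f c {N} N∈ fixed = ∈-vectorsFrom⁺ _ N row∈
    where
    row∈ : ∀ r → lookup N r ∈ RowMatrices.rowChoices Rows Cols (λ w → f (lookup w c)) r
    row∈ r with Rows r in Rr
    ... | true = ∈-filterᵇ⁺ (proj₁ (∈-filterᵇ⁻ (subsetsOf Cols) (row-accepted N∈ Rr))) (fixed r Rr)
    ... | false = subst (lookup N r ∈_) (if-false Rr) (∈-vectorsFrom⁻ rowChoices N∈ r)

  length-column-fixed : (f : Bool → Bool) → f true ≡ not (f false) → ∀ {c} → Cols c ≡ true →
    length (column-fixed f c) ≡ (2 ^ (count Cols ∸ 1)) ^ count Rows
  length-column-fixed f f-bij {c} Cc =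
    trans (RowMatrices.length-rowMatrices Rows Cols (λ w → f (lookup w c)))
          (cong (_^ count Rows) (length-subsetsOf-fixing f f-bij Cols c Cc))

  length-filterᵇ-column-fixed : (bad : AdjMatrix n → Bool) (f : Bool → Bool) → f true ≡ not (f false) →
    (∀ {N} → N ∈ rowMatrices → bad N ≡ true → ∃ λ c → Cols c ≡ true × (∀ r → Rows r ≡ true → f (entry N r c) ≡ true)) →
    length (filterᵇ bad rowMatrices) ≤ count Cols * (2 ^ (count Cols ∸ 1)) ^ count Rows
  length-filterᵇ-column-fixed bad f f-bij witness = begin
    length (filterᵇ bad rowMatrices) ≤⟨ Unique-⊆⇒length≤ (unique-filterᵇ unique-rowMatrices) bad⊆ ⟩
    length (concatMapᶠ columns) ≡⟨ length-concatMapᶠ columns ⟩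
    sumᶠ (length ∘ columns) ≡⟨ sumᶠ-if Cols _ _ length-columns ⟩
    count Cols * (2 ^ (count Cols ∸ 1)) ^ count Rows ∎
    where
    open ≤-Reasoning
    columns : Fin n → List (AdjMatrix n)
    columns c = if Cols c then column-fixed f c else []
    bad⊆ : ∀ {N} → N ∈ filterᵇ bad rowMatrices → N ∈ concatMapᶠ columns
    bad⊆ N∈bad with ∈-filterᵇ⁻ rowMatrices N∈bad
    ... | N∈ , badN with witness N∈ badN
    ... | c , Cc , fixed = ∈-concatMapᶠ⁺ columns c (subst (_ ∈_) (sym (if-true Cc)) (∈-column-fixed f c N∈ fixed))
    length-columns : ∀ c → length (columns c) ≡ (if Cols c then (2 ^ (count Cols ∸ 1)) ^ count Rows else 0)
    length-columns c with Cols c in Cc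
    ... | true = length-column-fixed f f-bij Cc
    ... | false = refl

length-filterᵇ-subsetsOf : (Cols : Fin n → Bool) (ok : Vec Bool n → Bool) (t : Vec Bool n) →
  t ∈ subsetsOf Cols → ok t ≡ false → (∀ {w} → w ∈ subsetsOf Cols → ok w ≡ false → w ≡ t) →
  length (filterᵇ ok (subsetsOf Cols)) ≡ 2 ^ count Cols ∸ 1
length-filterᵇ-subsetsOf Cols ok t t∈ okt only-t =
  trans (cong (_∸ 1) (length-filterᵇ-one-failure ok (unique-subsetsOf Cols) t∈ okt only-t))
        (cong (_∸ 1) (length-subsetsOf Cols))

module Encodings (v : Fin n) (X : Subset n) where
  open SplitGraph v X

  inI-true : ∀ {y} → inK y ≡ false → inI y ≡ true
  inI-true = cong not

  inK-false : ∀ {y} → inI y ≡ true → inK y ≡ false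
  inK-false = not≡true⇒≡false

  -- Encoding by rows indexed by I: the X-neighbourhood of each y ∈ I, a proper subset of X.

  missesX : Vec Bool n → Bool
  missesX w = anyᶠ (λ x → inX x ∧ not (lookup w x))

  module ByI = RowMatrices inI inX missesX

  graphI : AdjMatrix n → AdjMatrix n
  graphI N = splitGraph (λ x y → entry N y x)

  someXIsolated : AdjMatrix n → Bool
  someXIsolated N = anyᶠ (λ x → inX x ∧ not (anyᶠ (λ y → inI y ∧ entry N y x)))

  length-byI : length ByI.rowMatrices ≡ (2 ^ count inX ∸ 1) ^ count inI
  length-byI = trans ByI.length-rowMatrices (cong (_^ count inI)
    (length-filterᵇ-subsetsOf inX missesX X (∈-subsetsOf⁺ inX X (λ _ Xi → Xi)) X-full only-X))
    where
    X-full : missesX X ≡ false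
    X-full = anyᶠ-false⁺ _ (λ x → x∧not-x (inX x))
      where
      x∧not-x : ∀ b → b ∧ not b ≡ false
      x∧not-x true = refl
      x∧not-x false = refl
    only-X : ∀ {w} → w ∈ subsetsOf inX → missesX w ≡ false → w ≡ X
    only-X {w} w∈ full = vec-ext entries
      where
      entries : ∀ x → lookup w x ≡ inX x
      entries x with inX x in Xx | lookup w x in wx
      ... | true | true = refl
      ... | true | false = ⊥-elim (true≢false (trans (sym (cong₂ (λ b c → b ∧ not c) Xx wx)) (anyᶠ-false⁻ _ full x)))
      ... | false | false = refl
      ... | false | true = trans (sym (∈-subsetsOf⁻ inX w∈ x wx)) Xx

  admissible-byI : inX v ≡ false → ∀ {N} → N ∈ ByI.rowMatrices → someXIsolated N ≡ false →
    Admissible v X (λ x y → entry N y x)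
  admissible-byI Xv {N} N∈ none = Xv , nonNeighbour , neighbour
    where
    nonNeighbour : ∀ y → inK y ≡ false → ∃ λ x → inX x ≡ true × entry N y x ≡ false
    nonNeighbour y Ky with anyᶠ-true⁻ _ (ByI.ok-row N∈ (inI-true Ky))
    ... | x , found = x , ∧-conicalˡ _ _ found , not≡true⇒≡false (∧-conicalʳ _ _ found)
    neighbour : ∀ x → inX x ≡ true → ∃ λ y → inK y ≡ false × entry N y x ≡ true
    neighbour x Xx with anyᶠ-true⁻ _ (not≡false⇒≡true
      (subst (λ b → b ∧ not (anyᶠ (λ y → inI y ∧ entry N y x)) ≡ false) Xx (anyᶠ-false⁻ _ none x)))
    ... | y , found = y , inK-false (∧-conicalˡ _ _ found) , ∧-conicalʳ _ _ found

  byI-complete : ∀ M → Admissible v X (entry M) → (∀ x y → entry M x y ≡ entry M y x) →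
    M ≡ splitGraph (entry M) → restrict inI inX (entry M) ∈ ByI.rowMatrices × graphI (restrict inI inX (entry M)) ≡ M
  byI-complete M (_ , nonNeighbour , _) symM M≡G = N∈ , trans (splitGraph-cong agree) (sym M≡G)
    where
    N = restrict inI inX (entry M)
    N∈ : N ∈ ByI.rowMatrices
    N∈ = ByI.restrict∈rowMatrices (entry M) proper
      where
      proper : ∀ y → inI y ≡ true → missesX (tabulate (λ x → inX x ∧ entry M y x)) ≡ true
      proper y Iy with nonNeighbour y (inK-false Iy)
      ... | x , Xx , Mxy = anyᶠ-true⁺ _ x (subst (λ b → b ∧ not (lookup (tabulate (λ x → inX x ∧ entry M y x)) x) ≡ true) (sym Xx)
          (cong not (trans (lookup∘tabulate _ x) (trans (cong (_∧ entry M y x) Xx) (trans (symM y x) Mxy)))))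
    agree : ∀ {x y} → inX x ≡ true → inK y ≡ false → entry N y x ≡ entry M x y
    agree {x} {y} Xx Ky = trans (entry-tabulate _ y x)
      (trans (cong₂ (λ a b → a ∧ (b ∧ entry M y x)) (inI-true Ky) Xx) (symM y x))

  graphI-injective : ∀ {N N′} → N ∈ ByI.rowMatrices → N′ ∈ ByI.rowMatrices → graphI N ≡ graphI N′ → N ≡ N′
  graphI-injective {N} {N′} N∈ N′∈ eq = ByI.rowMatrices-ext N∈ N′∈ (λ {y} {x} Iy Xx →
    trans (sym (entry-XI _ Xx (inK-false Iy))) (trans (cong (λ G → entry G x y) eq) (entry-XI _ Xx (inK-false Iy))))

  length-someXIsolated : length (filterᵇ someXIsolated ByI.rowMatrices) ≤ count inX * (2 ^ (count inX ∸ 1)) ^ count inI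
  length-someXIsolated = ColumnBounds.length-filterᵇ-column-fixed inI inX missesX someXIsolated not refl witness
    where
    witness : ∀ {N} → N ∈ ByI.rowMatrices → someXIsolated N ≡ true →
      ∃ λ x → inX x ≡ true × (∀ y → inI y ≡ true → not (entry N y x) ≡ true)
    witness {N} _ some with anyᶠ-true⁻ _ some
    ... | x , found = x , ∧-conicalˡ _ _ found , λ y Iy →
      cong not (subst (λ b → b ∧ entry N y x ≡ false) Iy (anyᶠ-false⁻ _ (not≡true⇒≡false (∧-conicalʳ _ _ found)) y))

  -- Encoding by rows indexed by X: the I-neighbourhood of each x ∈ X, a nonempty subset of I.

  nonempty : Vec Bool n → Bool
  nonempty w = anyᶠ (lookup w)

  module ByX = RowMatrices inX inI nonempty

  graphX : AdjMatrix n → AdjMatrix n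
  graphX N = splitGraph (entry N)

  someIDominating : AdjMatrix n → Bool
  someIDominating N = anyᶠ (λ y → inI y ∧ not (anyᶠ (λ x → inX x ∧ not (entry N x y))))

  length-byX : length ByX.rowMatrices ≡ (2 ^ count inI ∸ 1) ^ count inX
  length-byX = trans ByX.length-rowMatrices (cong (_^ count inX)
    (length-filterᵇ-subsetsOf inI nonempty ∅ (∈-subsetsOf⁺ inI ∅ (λ i ∅i → ⊥-elim (true≢false (trans (sym ∅i) (lookup-replicate i _)))))
      (anyᶠ-false⁺ (lookup (∅ {n})) (λ i → lookup-replicate i false))
      (λ {w} _ empty → vec-ext (λ i → trans (anyᶠ-false⁻ _ empty i) (sym (lookup-replicate i _))))))

  admissible-byX : inX v ≡ false → ∀ {N} → N ∈ ByX.rowMatrices → someIDominating N ≡ false → Admissible v X (entry N)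
  admissible-byX Xv {N} N∈ none = Xv , nonNeighbour , neighbour
    where
    neighbour : ∀ x → inX x ≡ true → ∃ λ y → inK y ≡ false × entry N x y ≡ true
    neighbour x Xx with anyᶠ-true⁻ _ (ByX.ok-row N∈ Xx)
    ... | y , Nxy = y , inK-false (∈-subsetsOf⁻ inI (proj₁ (∈-filterᵇ⁻ _ (ByX.row-accepted N∈ Xx))) y Nxy) , Nxy
    nonNeighbour : ∀ y → inK y ≡ false → ∃ λ x → inX x ≡ true × entry N x y ≡ false
    nonNeighbour y Ky with anyᶠ-true⁻ _ (not≡false⇒≡true
      (subst (λ b → b ∧ not (anyᶠ (λ x → inX x ∧ not (entry N x y))) ≡ false) (inI-true Ky) (anyᶠ-false⁻ _ none y)))
    ... | x , found = x , ∧-conicalˡ _ _ found , not≡true⇒≡false (∧-conicalʳ _ _ found)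

  byX-complete : ∀ M → Admissible v X (entry M) →
    M ≡ splitGraph (entry M) → restrict inX inI (entry M) ∈ ByX.rowMatrices × graphX (restrict inX inI (entry M)) ≡ M
  byX-complete M (_ , _ , neighbour) M≡G = N∈ , trans (splitGraph-cong agree) (sym M≡G)
    where
    N = restrict inX inI (entry M)
    N∈ : N ∈ ByX.rowMatrices
    N∈ = ByX.restrict∈rowMatrices (entry M) has-neighbour
      where
      has-neighbour : ∀ x → inX x ≡ true → nonempty (tabulate (λ y → inI y ∧ entry M x y)) ≡ true
      has-neighbour x Xx with neighbour x Xx
      ... | y , Ky , Mxy = anyᶠ-true⁺ _ y (trans (lookup∘tabulate _ y) (trans (cong (_∧ entry M x y) (inI-true Ky)) Mxy))
    agree : ∀ {x y} → inX x ≡ true → inK y ≡ false → entry N x y ≡ entry M x y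
    agree {x} {y} Xx Ky = trans (entry-tabulate _ x y) (cong₂ (λ a b → a ∧ (b ∧ entry M x y)) Xx (inI-true Ky))

  graphX-injective : ∀ {N N′} → N ∈ ByX.rowMatrices → N′ ∈ ByX.rowMatrices → graphX N ≡ graphX N′ → N ≡ N′
  graphX-injective {N} {N′} N∈ N′∈ eq = ByX.rowMatrices-ext N∈ N′∈ (λ {x} {y} Xx Iy →
    trans (sym (entry-XI _ Xx (inK-false Iy))) (trans (cong (λ G → entry G x y) eq) (entry-XI _ Xx (inK-false Iy))))

  length-someIDominating : length (filterᵇ someIDominating ByX.rowMatrices) ≤ count inI * (2 ^ (count inI ∸ 1)) ^ count inX
  length-someIDominating = ColumnBounds.length-filterᵇ-column-fixed inX inI nonempty someIDominating (λ b → b) refl witness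
    where
    witness : ∀ {N} → N ∈ ByX.rowMatrices → someIDominating N ≡ true →
      ∃ λ y → inI y ≡ true × (∀ x → inX x ≡ true → entry N x y ≡ true)
    witness {N} _ some with anyᶠ-true⁻ _ some
    ... | y , found = y , ∧-conicalˡ _ _ found , λ x Xx →
      not≡false⇒≡true (subst (λ b → b ∧ not (entry N x y) ≡ false) Xx
        (anyᶠ-false⁻ _ (not≡true⇒≡false (∧-conicalʳ _ _ found)) x))

size : Subset n → ℕ
size X = count (lookup X)

count-insert : (v : Fin n) (p : Fin n → Bool) → p v ≡ false → count (λ x → (x ≡ᵇ v) ∨ p x) ≡ suc (count p)
count-insert zero p pv rewrite pv = refl
count-insert {suc n} (suc v) p pv = trans (cong ((if p zero then 1 else 0) +_) (count-insert v (p ∘ suc) pv)) (+-suc _ _)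

module _ (v : Fin n) (X : Subset n) where
  open SplitGraph v X

  count-inI : inX v ≡ false → count inI ≡ n ∸ size X ∸ 1
  count-inI Xv = begin
    count inI ≡⟨ m+n∸n≡m (count inI) (count inK) ⟨
    count inI + count inK ∸ count inK ≡⟨ cong (_∸ count inK) (count-not+count inK) ⟩
    n ∸ count inK ≡⟨ cong (n ∸_) (trans (count-insert v inX Xv) (+-comm 1 (size X))) ⟩
    n ∸ (size X + 1) ≡⟨ ∸-+-assoc n (size X) 1 ⟨
    n ∸ size X ∸ 1 ∎
    where open ≡-Reasoning

-- |X| ≥ 2: x ∈ X has a neighbour y ∈ I which has a non-neighbour x′ ∈ X, so x ≠ x′;
-- |I ∪ {v}| ≥ 2 since y ≠ v.
admissible-size : ∀ {m} (v : Fin (suc (suc m))) (X : Subset (suc (suc m))) e → Admissible v X e →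
  2 ≤ size X × 2 + size X ≤ suc (suc m)
admissible-size {m} v X e (Xv , nonNeighbour , neighbour) with some-x
  where
  open SplitGraph v X
  other : Fin (suc (suc m)) → Fin (suc (suc m))
  other zero = suc zero
  other (suc _) = zero
  other≢ : ∀ w → other w ≢ w
  other≢ zero ()
  other≢ (suc _) ()
  some-x : ∃ λ x → inX x ≡ true
  some-x with inX (other v) in Xu
  ... | true = other v , Xu
  ... | false = let x , Xx , _ = nonNeighbour (other v) (trans (inK-≢v (other≢ v)) Xu) in x , Xx
... | x , Xx with neighbour x Xx
... | y , Ky , exy with nonNeighbour y Ky
... | x′ , Xx′ , ex′y =
  count≥2 (lookup X) x≢x′ Xx Xx′ , count≤n∸2 (lookup X) (λ v≡y → ¬inK⇒≢v Ky (sym v≡y)) Xv (¬inK⇒¬inX Ky)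
  where
  open SplitGraph v X
  x≢x′ : x ≢ x′
  x≢x′ refl = true≢false (trans (sym exy) ex′y)

-- Σ over the subsets S of an m-element set of h |S|.
subsetSum : ℕ → (ℕ → ℕ) → ℕ
subsetSum zero h = h 0
subsetSum (suc m) h = subsetSum m h + subsetSum m (h ∘ suc)

avoiding : Fin n → List (Subset n)
avoiding v = filterᵇ (λ X → not (lookup X v)) (subsetsOf (λ _ → true))

∈-avoiding⁻ : ∀ {v : Fin n} {X} → X ∈ avoiding v → lookup X v ≡ false
∈-avoiding⁻ X∈ = not≡true⇒≡false (proj₂ (∈-filterᵇ⁻ (subsetsOf (λ _ → true)) X∈))

∈-avoiding⁺ : ∀ {v : Fin n} {X} → lookup X v ≡ false → X ∈ avoiding v
∈-avoiding⁺ {X = X} Xv = ∈-filterᵇ⁺ (∈-subsetsOf⁺ _ X (λ _ _ → refl)) (cong not Xv)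

sum-subsets : (m : ℕ) (h : ℕ → ℕ) → sum (map (h ∘ size) (subsetsOf {m} (λ _ → true))) ≡ subsetSum m h
sum-subsets zero h = +-identityʳ (h 0)
sum-subsets (suc m) h = begin
  sum (map (h ∘ size) (map (true ∷_) S ++ map (false ∷_) S))
    ≡⟨ cong sum (map-++ (h ∘ size) (map (true ∷_) S) _) ⟩
  sum (map (h ∘ size) (map (true ∷_) S) ++ map (h ∘ size) (map (false ∷_) S))
    ≡⟨ sum-++ (map (h ∘ size) (map (true ∷_) S)) _ ⟩
  sum (map (h ∘ size) (map (true ∷_) S)) + sum (map (h ∘ size) (map (false ∷_) S))
    ≡⟨ cong₂ _+_ (cong sum (sym (map-∘ S))) (cong sum (sym (map-∘ S))) ⟩
  sum (map (λ X → h (suc (size X))) S) + sum (map (h ∘ size) S)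
    ≡⟨ cong₂ _+_ (sum-subsets m (h ∘ suc)) (sum-subsets m h) ⟩
  subsetSum m (h ∘ suc) + subsetSum m h ≡⟨ +-comm (subsetSum m (h ∘ suc)) _ ⟩
  subsetSum m h + subsetSum m (h ∘ suc) ∎
  where
  open ≡-Reasoning
  S = subsetsOf {m} (λ _ → true)

sum-avoiding : ∀ {m} (v : Fin (suc m)) (h : ℕ → ℕ) → sum (map (h ∘ size) (avoiding v)) ≡ subsetSum m h
sum-avoiding {m} zero h = begin
  sum (map (h ∘ size) (filterᵇ (λ X → not (lookup X zero)) (map (true ∷_) S ++ map (false ∷_) S)))
    ≡⟨ cong (sum ∘ map (h ∘ size)) (filterᵇ-split _ S) ⟩
  sum (map (h ∘ size) (map (true ∷_) (filterᵇ (λ _ → false) S) ++ map (false ∷_) (filterᵇ (λ _ → true) S)))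
    ≡⟨ cong₂ (λ ys zs → sum (map (h ∘ size) (map (true ∷_) ys ++ map (false ∷_) zs))) (filterᵇ-const false S) (filterᵇ-const true S) ⟩
  sum (map (h ∘ size) (map (false ∷_) S)) ≡⟨ cong sum (sym (map-∘ S)) ⟩
  sum (map (h ∘ size) S) ≡⟨ sum-subsets m h ⟩
  subsetSum m h ∎
  where
  open ≡-Reasoning
  S = subsetsOf {m} (λ _ → true)
sum-avoiding {suc m} (suc v) h = begin
  sum (map (h ∘ size) (filterᵇ p (map (true ∷_) S ++ map (false ∷_) S)))
    ≡⟨ cong (sum ∘ map (h ∘ size)) (filterᵇ-split p S) ⟩
  sum (map (h ∘ size) (map (true ∷_) Av ++ map (false ∷_) Av))
    ≡⟨ cong sum (map-++ (h ∘ size) (map (true ∷_) Av) _) ⟩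
  sum (map (h ∘ size) (map (true ∷_) Av) ++ map (h ∘ size) (map (false ∷_) Av))
    ≡⟨ sum-++ (map (h ∘ size) (map (true ∷_) Av)) _ ⟩
  sum (map (h ∘ size) (map (true ∷_) Av)) + sum (map (h ∘ size) (map (false ∷_) Av))
    ≡⟨ cong₂ _+_ (cong sum (sym (map-∘ Av))) (cong sum (sym (map-∘ Av))) ⟩
  sum (map (λ X → h (suc (size X))) Av) + sum (map (h ∘ size) Av)
    ≡⟨ cong₂ _+_ (sum-avoiding v (h ∘ suc)) (sum-avoiding v h) ⟩
  subsetSum m (h ∘ suc) + subsetSum m h ≡⟨ +-comm (subsetSum m (h ∘ suc)) _ ⟩
  subsetSum m h + subsetSum m (h ∘ suc) ∎
  where
  open ≡-Reasoning
  p = λ (X : Subset (suc (suc m))) → not (lookup X (suc v))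
  S = subsetsOf {suc m} (λ _ → true)
  Av = avoiding v

half : ℕ → ℕ
half n = (n ∸ 1) / 2

inRange : ℕ → ℕ → Bool
inRange n c = (2 ≤ᵇ c) ∧ (c ≤ᵇ n ∸ 2)

piecewise : ℕ → (ℕ → ℕ) → (ℕ → ℕ) → ℕ → ℕ
piecewise n low high c = if inRange n c then (if c ≤ᵇ half n then low c else high c) else 0

-- The number of graphs with given v and |X| = c satisfying the condition kept by the
-- encoding chosen for c; the paper's approximating sum is n Σ (n-1 choose c) (upper n c).
upper₁ upper₂ upper : ℕ → ℕ → ℕ
upper₁ n c = (2 ^ c ∸ 1) ^ (n ∸ c ∸ 1)
upper₂ n c = (2 ^ (n ∸ c ∸ 1) ∸ 1) ^ c
upper n = piecewise n (upper₁ n) (upper₂ n)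

-- A bound on how many of those violate the other condition.
slack₁ slack₂ slack : ℕ → ℕ → ℕ
slack₁ n c = c * (2 ^ (c ∸ 1)) ^ (n ∸ c ∸ 1)
slack₂ n c = (n ∸ c ∸ 1) * (2 ^ (n ∸ c ∸ 1 ∸ 1)) ^ c
slack n = piecewise n (slack₁ n) (slack₂ n)

module Blocks (v : Fin n) (X : Subset n) where
  open SplitGraph v X
  open Encodings v X

  eligible : Bool
  eligible = not (inX v) ∧ inRange n (size X)

  candidates : List (AdjMatrix n)
  candidates = if eligible
    then (if size X ≤ᵇ half n then map graphI ByI.rowMatrices else map graphX ByX.rowMatrices)
    else []

  admissibles : List (AdjMatrix n)
  admissibles = if eligible
    then (if size X ≤ᵇ half n then map graphI (filterᵇ (not ∘ someXIsolated) ByI.rowMatrices)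
                                else map graphX (filterᵇ (not ∘ someIDominating) ByX.rowMatrices))
    else []

  module _ (X∈ : X ∈ avoiding v) where

    private
      Xv = ∈-avoiding⁻ X∈
      c = size X

    length-candidates : length candidates ≡ upper n c
    length-candidates rewrite Xv with inRange n c
    ... | false = refl
    ... | true with c ≤ᵇ half n
    ... | true = trans (length-map graphI ByI.rowMatrices) (trans length-byI (cong ((2 ^ c ∸ 1) ^_) (count-inI v X Xv)))
    ... | false = trans (length-map graphX ByX.rowMatrices) (trans length-byX (cong (λ i → (2 ^ i ∸ 1) ^ c) (count-inI v X Xv)))

    length-admissibles : upper n c ≤ length admissibles + slack n c
    length-admissibles rewrite Xv with inRange n c
    ... | false = z≤n
    ... | true with c ≤ᵇ half n
    ... | true = begin
      (2 ^ c ∸ 1) ^ (n ∸ c ∸ 1) ≡⟨ cong ((2 ^ c ∸ 1) ^_) (count-inI v X Xv) ⟨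
      (2 ^ c ∸ 1) ^ count inI ≡⟨ length-byI ⟨
      length ByI.rowMatrices ≤⟨ length≤good+bad graphI someXIsolated ByI.rowMatrices ⟩
      length (map graphI (filterᵇ (not ∘ someXIsolated) ByI.rowMatrices)) + length (filterᵇ someXIsolated ByI.rowMatrices)
        ≤⟨ +-monoʳ-≤ _ length-someXIsolated ⟩
      length (map graphI (filterᵇ (not ∘ someXIsolated) ByI.rowMatrices)) + c * (2 ^ (c ∸ 1)) ^ count inI
        ≡⟨ cong (λ i → length (map graphI (filterᵇ (not ∘ someXIsolated) ByI.rowMatrices)) + c * (2 ^ (c ∸ 1)) ^ i) (count-inI v X Xv) ⟩
      length (map graphI (filterᵇ (not ∘ someXIsolated) ByI.rowMatrices)) + c * (2 ^ (c ∸ 1)) ^ (n ∸ c ∸ 1) ∎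
      where open ≤-Reasoning
    ... | false = begin
      (2 ^ (n ∸ c ∸ 1) ∸ 1) ^ c ≡⟨ cong (λ i → (2 ^ i ∸ 1) ^ c) (count-inI v X Xv) ⟨
      (2 ^ count inI ∸ 1) ^ c ≡⟨ length-byX ⟨
      length ByX.rowMatrices ≤⟨ length≤good+bad graphX someIDominating ByX.rowMatrices ⟩
      length (map graphX (filterᵇ (not ∘ someIDominating) ByX.rowMatrices)) + length (filterᵇ someIDominating ByX.rowMatrices)
        ≤⟨ +-monoʳ-≤ _ length-someIDominating ⟩
      length (map graphX (filterᵇ (not ∘ someIDominating) ByX.rowMatrices)) + count inI * (2 ^ (count inI ∸ 1)) ^ c
        ≡⟨ cong (λ i → length (map graphX (filterᵇ (not ∘ someIDominating) ByX.rowMatrices)) + i * (2 ^ (i ∸ 1)) ^ c) (count-inI v X Xv) ⟩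
      length (map graphX (filterᵇ (not ∘ someIDominating) ByX.rowMatrices)) + (n ∸ c ∸ 1) * (2 ^ (n ∸ c ∸ 1 ∸ 1)) ^ c ∎
      where open ≤-Reasoning

  sound : ∀ {M} → M ∈ admissibles → IsSplitQ1 M × QIsSingleton M v × lookup M v ≡ X
  sound {M} M∈ with eligible in el
  ... | true with inX v in Xv | size X ≤ᵇ half n
  ... | false | true with ∈-map⁻ graphI M∈
  ... | N , N∈ , refl = let N∈D , ok = ∈-filterᵇ⁻ ByI.rowMatrices N∈ in
    splitGraph-sound v X _ (admissible-byI Xv N∈D (not≡true⇒≡false ok))
  sound {M} M∈ | true | false | false with ∈-map⁻ graphX M∈
  ... | N , N∈ , refl = let N∈D , ok = ∈-filterᵇ⁻ ByX.rowMatrices N∈ in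
    splitGraph-sound v X _ (admissible-byX Xv N∈D (not≡true⇒≡false ok))

  unique-admissibles : Unique admissibles
  unique-admissibles with eligible
  ... | false = []
  ... | true with size X ≤ᵇ half n
  ... | true = unique-map (λ p q → graphI-injective (proj₁ (∈-filterᵇ⁻ _ p)) (proj₁ (∈-filterᵇ⁻ _ q)))
                          (unique-filterᵇ ByI.unique-rowMatrices)
  ... | false = unique-map (λ p q → graphX-injective (proj₁ (∈-filterᵇ⁻ _ p)) (proj₁ (∈-filterᵇ⁻ _ q)))
                           (unique-filterᵇ ByX.unique-rowMatrices)

candidates-complete : ∀ {m} {M : AdjMatrix (suc (suc m))} → IsSplitQ1 M →
  ∃ λ v → lookup M v ∈ avoiding v × M ∈ Blocks.candidates v (lookup M v)
candidates-complete {m} {M} isQ1 with splitGraph-complete M isQ1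
... | v , adm , M≡G = v , ∈-avoiding⁺ Xv , M∈
  where
  X = lookup M v
  open SplitGraph v X
  open Encodings v X
  open Blocks v X
  Xv = proj₁ adm
  size-range = admissible-size v X (entry M) adm
  eligible≡true : eligible ≡ true
  eligible≡true rewrite Xv
    | Equivalence.to T-≡ (≤⇒≤ᵇ (proj₁ size-range))
    | Equivalence.to T-≡ (≤⇒≤ᵇ (≤-trans (≤-reflexive (sym (m+n∸m≡n 2 (size X)))) (∸-monoˡ-≤ 2 (proj₂ size-range)))) = refl
  M∈ : M ∈ candidates
  M∈ rewrite eligible≡true with size X ≤ᵇ half (suc (suc m))
  ... | true = let N∈ , graph≡M = byI-complete M adm (proj₂ (proj₁ isQ1)) M≡G in
    subst (_∈ map graphI ByI.rowMatrices) graph≡M (∈-map⁺ graphI N∈)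
  ... | false = let N∈ , graph≡M = byX-complete M adm M≡G in
    subst (_∈ map graphX ByX.rowMatrices) graph≡M (∈-map⁺ graphX N∈)

enumerate : ∀ {n} → (Fin n → Subset n → List (AdjMatrix n)) → List (AdjMatrix n)
enumerate {n} f = concatMap (λ v → concatMap (f v) (avoiding v)) (allFin n)

module _ {m : ℕ} where

  private
    Σ-avoiding : (Fin (suc m) → Subset (suc m) → ℕ) → ℕ
    Σ-avoiding g = sum (map (λ v → sum (map (g v) (avoiding v))) (allFin (suc m)))

    length-enumerate : (f : Fin (suc m) → Subset (suc m) → List (AdjMatrix (suc m))) →
      length (enumerate f) ≡ Σ-avoiding (λ v X → length (f v X))
    length-enumerate f = trans (length-concatMap (λ v → concatMap (f v) (avoiding v)) (allFin (suc m)))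
      (sum-map-cong _ _ (allFin (suc m)) (λ v _ → length-concatMap (f v) (avoiding v)))

    Σ-avoiding-size : (h : ℕ → ℕ) → Σ-avoiding (λ _ X → h (size X)) ≡ suc m * subsetSum m h
    Σ-avoiding-size h = begin
      Σ-avoiding (λ _ X → h (size X)) ≡⟨ sum-map-cong _ _ (allFin (suc m)) (λ v _ → sum-avoiding v h) ⟩
      sum (map (λ _ → subsetSum m h) (allFin (suc m))) ≡⟨ sum-map-const (subsetSum m h) (allFin (suc m)) ⟩
      length (allFin (suc m)) * subsetSum m h ≡⟨ cong (_* subsetSum m h) (length-tabulate {n = suc m} (λ i → i)) ⟩
      suc m * subsetSum m h ∎
      where open ≡-Reasoning

  length-enumerate≡ : (f : Fin (suc m) → Subset (suc m) → List (AdjMatrix (suc m))) (h : ℕ → ℕ) →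
    (∀ v X → X ∈ avoiding v → length (f v X) ≡ h (size X)) → length (enumerate f) ≡ suc m * subsetSum m h
  length-enumerate≡ f h exact = begin
    length (enumerate f) ≡⟨ length-enumerate f ⟩
    Σ-avoiding (λ v X → length (f v X))
      ≡⟨ sum-map-cong _ _ (allFin (suc m)) (λ v _ → sum-map-cong _ _ (avoiding v) (exact v)) ⟩
    Σ-avoiding (λ _ X → h (size X)) ≡⟨ Σ-avoiding-size h ⟩
    suc m * subsetSum m h ∎
    where open ≡-Reasoning

  length-enumerate≥ : (f : Fin (suc m) → Subset (suc m) → List (AdjMatrix (suc m))) (h h′ : ℕ → ℕ) →
    (∀ v X → X ∈ avoiding v → h (size X) ≤ length (f v X) + h′ (size X)) →
    suc m * subsetSum m h ≤ length (enumerate f) + suc m * subsetSum m h′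
  length-enumerate≥ f h h′ bound = begin
    suc m * subsetSum m h ≡⟨ Σ-avoiding-size h ⟨
    Σ-avoiding (λ _ X → h (size X))
      ≤⟨ sum-map-mono _ _ (allFin (suc m)) (λ v _ → sum-map-mono _ _ (avoiding v) (bound v)) ⟩
    Σ-avoiding (λ v X → length (f v X) + h′ (size X))
      ≡⟨ sum-map-cong _ _ (allFin (suc m)) (λ v _ → sum-map-+ (λ X → length (f v X)) (h′ ∘ size) (avoiding v)) ⟩
    sum (map (λ v → sum (map (λ X → length (f v X)) (avoiding v)) + sum (map (h′ ∘ size) (avoiding v))) (allFin (suc m)))
      ≡⟨ sum-map-+ (λ v → sum (map (λ X → length (f v X)) (avoiding v))) (λ v → sum (map (h′ ∘ size) (avoiding v))) (allFin (suc m)) ⟩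
    Σ-avoiding (λ v X → length (f v X)) + Σ-avoiding (λ _ X → h′ (size X))
      ≡⟨ cong₂ _+_ (sym (length-enumerate f)) (Σ-avoiding-size h′) ⟩
    length (enumerate f) + suc m * subsetSum m h′ ∎
    where open ≤-Reasoning

unique-enumerate-admissibles : ∀ {n} → Unique (enumerate {n} Blocks.admissibles)
unique-enumerate-admissibles {n} =
  unique-concatMap (allFin⁺ n) (λ v → unique-concatMap (unique-filterᵇ (unique-subsetsOf _)) (Blocks.unique-admissibles v) same-X) same-v
  where
  same-X : ∀ {v X X′ M} → M ∈ Blocks.admissibles v X → M ∈ Blocks.admissibles v X′ → X ≡ X′
  same-X M∈ M∈′ = trans (sym (proj₂ (proj₂ (Blocks.sound _ _ M∈)))) (proj₂ (proj₂ (Blocks.sound _ _ M∈′)))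
  same-v : ∀ {v v′ M} → M ∈ concatMap (Blocks.admissibles v) (avoiding v) →
    M ∈ concatMap (Blocks.admissibles v′) (avoiding v′) → v ≡ v′
  same-v {v} {v′} M∈ M∈′ with ∈-concatMap⁻′ (avoiding v) M∈ | ∈-concatMap⁻′ (avoiding v′) M∈′
  ... | X , _ , M∈X | X′ , _ , M∈X′ =
    let (v∈Q , only-v) , _ = proj₂ (Blocks.sound v X M∈X) ; (v′∈Q , _) , _ = proj₂ (Blocks.sound v′ X′ M∈X′) in
    sym (only-v v′ v′∈Q)

length≤upper : ∀ {m} (L : List (AdjMatrix (suc (suc m)))) → Unique L → (∀ {M} → M ∈ L → IsSplitQ1 M) →
  length L ≤ suc (suc m) * subsetSum (suc m) (upper (suc (suc m)))
length≤upper {m} L unique-L Q1 = ≤-trans (Unique-⊆⇒length≤ unique-L L⊆)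
  (≤-reflexive (length-enumerate≡ Blocks.candidates (upper (suc (suc m))) (λ v X → Blocks.length-candidates v X)))
  where
  L⊆ : ∀ {M} → M ∈ L → M ∈ enumerate Blocks.candidates
  L⊆ M∈ with candidates-complete (Q1 M∈)
  ... | v , X∈ , M∈X = ∈-concatMap⁺′ {f = λ v → concatMap (Blocks.candidates v) (avoiding v)} (∈-allFin v)
    (∈-concatMap⁺′ {f = Blocks.candidates v} X∈ M∈X)

upper≤length+slack : ∀ {m} (L : List (AdjMatrix (suc (suc m)))) → (∀ {M} → IsSplitQ1 M → M ∈ L) →
  suc (suc m) * subsetSum (suc m) (upper (suc (suc m))) ≤ length L + suc (suc m) * subsetSum (suc m) (slack (suc (suc m)))
upper≤length+slack {m} L Q1 =
  ≤-trans (length-enumerate≥ Blocks.admissibles (upper (suc (suc m))) (slack (suc (suc m))) (λ v X → Blocks.length-admissibles v X))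
    (+-monoˡ-≤ _ (Unique-⊆⇒length≤ unique-enumerate-admissibles ⊆L))
  where
  ⊆L : ∀ {M} → M ∈ enumerate Blocks.admissibles → M ∈ L
  ⊆L M∈ with ∈-concatMap⁻′ (allFin (suc (suc m))) M∈
  ... | v , _ , M∈v with ∈-concatMap⁻′ (avoiding v) M∈v
  ... | X , _ , M∈X = Q1 (proj₁ (Blocks.sound v X M∈X))

-- The approximating sum

sumTo : ℕ → (ℕ → ℕ) → ℕ
sumTo zero F = 0
sumTo (suc k) F = F 0 + sumTo k (F ∘ suc)

sumTo-cong : ∀ k {F G : ℕ → ℕ} → (∀ i → i < k → F i ≡ G i) → sumTo k F ≡ sumTo k G
sumTo-cong zero eq = refl
sumTo-cong (suc k) eq = cong₂ _+_ (eq 0 (s≤s z≤n)) (sumTo-cong k (λ i i<k → eq (suc i) (s≤s i<k)))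

sumTo-zero : ∀ k {F : ℕ → ℕ} → (∀ i → i < k → F i ≡ 0) → sumTo k F ≡ 0
sumTo-zero k eq = trans (sumTo-cong k eq) (zeros k)
  where
  zeros : ∀ k → sumTo k (λ _ → 0) ≡ 0
  zeros zero = refl
  zeros (suc k) = zeros k

sumTo-+ : ∀ a b (F : ℕ → ℕ) → sumTo (a + b) F ≡ sumTo a F + sumTo b (λ i → F (a + i))
sumTo-+ zero b F = refl
sumTo-+ (suc a) b F = trans (cong (F 0 +_) (sumTo-+ a b (F ∘ suc))) (sym (+-assoc (F 0) _ _))

sumTo-snoc : ∀ k (F : ℕ → ℕ) → sumTo (suc k) F ≡ sumTo k F + F k
sumTo-snoc k F = trans (cong (λ j → sumTo j F) (+-comm 1 k))
  (trans (sumTo-+ k 1 F) (cong (sumTo k F +_) (trans (+-identityʳ _) (cong F (+-identityʳ k)))))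

sumTo-add : ∀ k (F G : ℕ → ℕ) → sumTo k (λ i → F i + G i) ≡ sumTo k F + sumTo k G
sumTo-add zero F G = refl
sumTo-add (suc k) F G = trans (cong (F 0 + G 0 +_) (sumTo-add k (F ∘ suc) (G ∘ suc))) (interchange (F 0) (G 0) _ _)

sumTo-*ˡ : ∀ k c (F : ℕ → ℕ) → sumTo k (λ i → c * F i) ≡ c * sumTo k F
sumTo-*ˡ zero c F = sym (*-zeroʳ c)
sumTo-*ˡ (suc k) c F = trans (cong (c * F 0 +_) (sumTo-*ˡ k c (F ∘ suc))) (sym (*-distribˡ-+ c (F 0) _))

sumRange≡sumTo : ∀ a b f → sumRange a b f ≡ sumTo (suc b ∸ a) (λ i → f (a + i))
sumRange≡sumTo a b f = go (λ i → i) (suc b ∸ a)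
  where
  go : ∀ (h : ℕ → ℕ) k → sum (map f (map (a +_) (applyUpTo h k))) ≡ sumTo k (λ i → f (a + h i))
  go h zero = refl
  go h (suc k) = cong (f (a + h 0) +_) (go (h ∘ suc) k)

subsetSum≡sumTo : ∀ m h → subsetSum m h ≡ sumTo (suc m) (λ c → (m C c) * h c)
subsetSum≡sumTo zero h = sym (trans (+-identityʳ (1 * h 0)) (*-identityˡ (h 0)))
subsetSum≡sumTo (suc m) h = begin
  subsetSum m h + subsetSum m (h ∘ suc)
    ≡⟨ cong₂ _+_ (subsetSum≡sumTo m h) (subsetSum≡sumTo m (h ∘ suc)) ⟩
  sumTo (suc m) (λ c → (m C c) * h c) + sumTo (suc m) (λ c → (m C c) * h (suc c))
    ≡⟨ cong (_+ sumTo (suc m) (λ c → (m C c) * h (suc c))) (cong (_+ sumTo m G) (*-identityˡ (h 0))) ⟩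
  h 0 + sumTo m G + sumTo (suc m) (λ c → (m C c) * h (suc c))
    ≡⟨ cong (λ s → h 0 + s + sumTo (suc m) (λ c → (m C c) * h (suc c))) G-padded ⟩
  h 0 + sumTo (suc m) G + sumTo (suc m) (λ c → (m C c) * h (suc c))
    ≡⟨ +-assoc (h 0) _ _ ⟩
  h 0 + (sumTo (suc m) G + sumTo (suc m) (λ c → (m C c) * h (suc c)))
    ≡⟨ cong (h 0 +_) (trans (+-comm (sumTo (suc m) G) _) (sym (sumTo-add (suc m) (λ c → (m C c) * h (suc c)) G))) ⟩
  h 0 + sumTo (suc m) (λ c → (m C c) * h (suc c) + G c)
    ≡⟨ cong₂ _+_ (sym (*-identityˡ (h 0))) (sumTo-cong (suc m) (λ c _ → pascal c)) ⟩
  sumTo (suc (suc m)) (λ c → (suc m C c) * h c) ∎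
  where
  open ≡-Reasoning
  G : ℕ → ℕ
  G c = (m C suc c) * h (suc c)
  G-padded : sumTo m G ≡ sumTo (suc m) G
  G-padded = sym (trans (sumTo-snoc m G)
    (trans (cong (sumTo m G +_) (cong (_* h (suc m)) (k>n⇒nCk≡0 (n<1+n m)))) (+-identityʳ _)))
  pascal : ∀ c → (m C c) * h (suc c) + G c ≡ (suc m C suc c) * h (suc c)
  pascal c = trans (sym (*-distribʳ-+ (h (suc c)) (m C c) (m C suc c))) (cong (_* h (suc c)) (nCk+nC[k+1]≡[n+1]C[k+1] m c))

sumTo-ranges : ∀ a b (G : ℕ → ℕ) → sumTo (2 + (a + (b + 1))) G ≡
  sumTo 2 G + (sumTo a (λ i → G (2 + i)) + (sumTo b (λ i → G (2 + (a + i))) + sumTo 1 (λ i → G (2 + (a + (b + i))))))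
sumTo-ranges a b G = begin
  sumTo (2 + (a + (b + 1))) G ≡⟨ sumTo-+ 2 (a + (b + 1)) G ⟩
  sumTo 2 G + sumTo (a + (b + 1)) (λ i → G (2 + i)) ≡⟨ cong (sumTo 2 G +_) (sumTo-+ a (b + 1) (λ i → G (2 + i))) ⟩
  sumTo 2 G + (sumTo a (λ i → G (2 + i)) + sumTo (b + 1) (λ i → G (2 + (a + i))))
    ≡⟨ cong (λ s → sumTo 2 G + (sumTo a (λ i → G (2 + i)) + s)) (sumTo-+ b 1 (λ i → G (2 + (a + i)))) ⟩
  sumTo 2 G + (sumTo a (λ i → G (2 + i)) + (sumTo b (λ i → G (2 + (a + i))) + sumTo 1 (λ i → G (2 + (a + (b + i)))))) ∎
  where open ≡-Reasoning

*-subsetSum≡sumTo : ∀ m h → suc m * subsetSum m h ≡ sumTo (suc m) (λ c → suc m * ((m C c) * h c))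
*-subsetSum≡sumTo m h =
  trans (cong (suc m *_) (subsetSum≡sumTo m h)) (sym (sumTo-*ˡ (suc m) (suc m) (λ c → (m C c) * h c)))

half-bounds : ∀ n → 5 ≤ n → 1 ≤ half n × half n ≤ n ∸ 2
half-bounds n@(suc (suc (suc (suc (suc k))))) (s≤s (s≤s (s≤s (s≤s (s≤s z≤n))))) = 1≤q , q≤n∸2
  where
  q = half n
  1≤q : 1 ≤ q
  1≤q = ≤-trans (s≤s z≤n) (≤-reflexive (sym (m/n≡1+[m∸n]/n {suc (suc (suc (suc k)))} {2} (s≤s (s≤s z≤n)))))
  q≤n∸2 : q ≤ n ∸ 2
  q≤n∸2 = ≤-pred (begin
    suc q ≡⟨ +-comm 1 q ⟩
    q + 1 ≤⟨ +-monoʳ-≤ q 1≤q ⟩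
    q + q ≡⟨ cong (q +_) (sym (+-identityʳ q)) ⟩
    q + (q + 0) ≡⟨ *-comm 2 q ⟩
    q * 2 ≤⟨ m/n*n≤m (n ∸ 1) 2 ⟩
    n ∸ 1 ∎)
    where open ≤-Reasoning

module PiecewiseCases (n : ℕ) (low high : ℕ → ℕ) where

  private
    ≤ᵇ-true : ∀ {c d} → c ≤ d → (c ≤ᵇ d) ≡ true
    ≤ᵇ-true c≤d = Equivalence.to T-≡ (≤⇒≤ᵇ c≤d)

    ≤ᵇ-false : ∀ {c d} → d < c → (c ≤ᵇ d) ≡ false
    ≤ᵇ-false {c} {d} d<c with c ≤ᵇ d in eq
    ... | false = refl
    ... | true = ⊥-elim (<⇒≱ d<c (≤ᵇ⇒≤ c d (Equivalence.from T-≡ eq)))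

  piecewise-<2 : ∀ {c} → c < 2 → piecewise n low high c ≡ 0
  piecewise-<2 c<2 rewrite ≤ᵇ-false {2} c<2 = refl

  piecewise->n∸2 : ∀ {c} → n ∸ 2 < c → piecewise n low high c ≡ 0
  piecewise->n∸2 {c} c> with 2 ≤ᵇ c
  ... | false = refl
  ... | true rewrite ≤ᵇ-false {c} c> = refl

  piecewise-low : ∀ {c} → 2 ≤ c → c ≤ half n → half n ≤ n ∸ 2 → piecewise n low high c ≡ low c
  piecewise-low 2≤c c≤q q≤ rewrite ≤ᵇ-true 2≤c | ≤ᵇ-true (≤-trans c≤q q≤) | ≤ᵇ-true c≤q = refl

  piecewise-high : ∀ {c} → 2 ≤ c → half n < c → c ≤ n ∸ 2 → piecewise n low high c ≡ high c
  piecewise-high {c} 2≤c q<c c≤ rewrite ≤ᵇ-true 2≤c | ≤ᵇ-true c≤ | ≤ᵇ-false {c} q<c = refl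

approxSum≡ : ∀ n → 5 ≤ n → approxSum n ≡ n * subsetSum (n ∸ 1) (upper n)
approxSum≡ n@(suc m) 5≤n = begin
  approxSum n
    ≡⟨ cong₂ _+_ (sumRange≡sumTo 2 q f₁) (sumRange≡sumTo (suc q) (n ∸ 2) f₂) ⟩
  sumTo a (λ i → f₁ (2 + i)) + sumTo b (λ i → f₂ (suc q + i))
    ≡⟨ cong₂ _+_ (sumTo-cong a low-terms) (sumTo-cong b high-terms) ⟩
  sumTo a (λ i → G (2 + i)) + sumTo b (λ i → G (2 + (a + i)))
    ≡⟨ cong (sumTo a (λ i → G (2 + i)) +_) (+-identityʳ _) ⟨
  sumTo a (λ i → G (2 + i)) + (sumTo b (λ i → G (2 + (a + i))) + 0)
    ≡⟨ cong₂ (λ x y → x + (sumTo a (λ i → G (2 + i)) + (sumTo b (λ i → G (2 + (a + i))) + y))) first-two last-one ⟨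
  sumTo 2 G + (sumTo a (λ i → G (2 + i)) + (sumTo b (λ i → G (2 + (a + i))) + sumTo 1 (λ i → G (2 + (a + (b + i))))))
    ≡⟨ sumTo-ranges a b G ⟨
  sumTo (2 + (a + (b + 1))) G ≡⟨ cong (λ k → sumTo k G) length≡n ⟩
  sumTo n G ≡⟨ *-subsetSum≡sumTo m (upper n) ⟨
  n * subsetSum m (upper n) ∎
  where
  open ≡-Reasoning
  open PiecewiseCases n (upper₁ n) (upper₂ n)
  q = half n
  a = q ∸ 1
  b = n ∸ 2 ∸ q
  1≤q = proj₁ (half-bounds n 5≤n)
  q≤n∸2 = proj₂ (half-bounds n 5≤n)
  f₁ f₂ G : ℕ → ℕ
  f₁ c = n * (m C c) * ((2 ^ c ∸ 1) ^ (n ∸ c ∸ 1))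
  f₂ c = n * (m C c) * ((2 ^ (n ∸ c ∸ 1) ∸ 1) ^ c)
  G c = n * ((m C c) * upper n c)
  1+a≡q : suc a ≡ q
  1+a≡q = m+[n∸m]≡n 1≤q
  q+b≡n∸2 : q + b ≡ n ∸ 2
  q+b≡n∸2 = m+[n∸m]≡n q≤n∸2
  length≡n : 2 + (a + (b + 1)) ≡ n
  length≡n = begin
    2 + (a + (b + 1)) ≡⟨ cong (λ k → 2 + (a + k)) (+-comm b 1) ⟩
    2 + (a + suc b) ≡⟨ cong (2 +_) (+-suc a b) ⟩
    2 + (suc a + b) ≡⟨ cong (λ k → 2 + (k + b)) 1+a≡q ⟩
    2 + (q + b) ≡⟨ cong (2 +_) q+b≡n∸2 ⟩
    2 + (n ∸ 2) ≡⟨ m+[n∸m]≡n (≤-trans (s≤s (s≤s z≤n)) 5≤n) ⟩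
    n ∎
  vanishes : ∀ c → upper n c ≡ 0 → G c ≡ 0
  vanishes c eq = trans (cong (λ u → n * ((m C c) * u)) eq) (trans (cong (n *_) (*-zeroʳ (m C c))) (*-zeroʳ n))
  first-two : sumTo 2 G ≡ 0
  first-two = sumTo-zero 2 {G} (λ i i<2 → vanishes i (piecewise-<2 i<2))
  last-one : sumTo 1 (λ i → G (2 + (a + (b + i)))) ≡ 0
  last-one = sumTo-zero 1 {λ i → G (2 + (a + (b + i)))} λ where
    zero _ → vanishes (2 + (a + (b + 0))) (piecewise->n∸2 (≤-reflexive (sym
      (trans (cong (λ k → 2 + (a + k)) (+-identityʳ b)) (cong suc (trans (cong (_+ b) 1+a≡q) q+b≡n∸2))))))
    (suc _) (s≤s ())
  low-terms : ∀ i → i < a → f₁ (2 + i) ≡ G (2 + i)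
  low-terms i i<a = trans (*-assoc n (m C (2 + i)) _) (cong (λ u → n * ((m C (2 + i)) * u))
    (sym (piecewise-low {2 + i} (s≤s (s≤s z≤n)) (subst (2 + i ≤_) 1+a≡q (s≤s i<a)) q≤n∸2)))
  high-terms : ∀ i → i < b → f₂ (suc q + i) ≡ G (2 + (a + i))
  high-terms i i<b = trans (cong f₂ (cong (λ k → suc k + i) (sym 1+a≡q))) (trans (*-assoc n (m C (2 + (a + i))) _) (cong (λ u → n * ((m C (2 + (a + i))) * u))
    (sym (piecewise-high {2 + (a + i)} (s≤s (s≤s z≤n)) (subst (_< 2 + (a + i)) 1+a≡q (s≤s (s≤s (m≤m+n a i))))
      (subst (2 + (a + i) ≤_) (trans (cong (_+ b) 1+a≡q) q+b≡n∸2) (≤-trans (≤-reflexive (sym (+-suc (suc a) i))) (+-monoʳ-≤ (suc a) i<b)))))))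

-- Estimates

subsetSum-mono : ∀ m {f g : ℕ → ℕ} → (∀ c → f c ≤ g c) → subsetSum m f ≤ subsetSum m g
subsetSum-mono zero f≤g = f≤g 0
subsetSum-mono (suc m) f≤g = +-mono-≤ (subsetSum-mono m f≤g) (subsetSum-mono m (f≤g ∘ suc))

subsetSum-+ : ∀ m (f g : ℕ → ℕ) → subsetSum m (λ c → f c + g c) ≡ subsetSum m f + subsetSum m g
subsetSum-+ zero f g = refl
subsetSum-+ (suc m) f g = trans (cong₂ _+_ (subsetSum-+ m f g) (subsetSum-+ m (f ∘ suc) (g ∘ suc)))
  (+-+-comm (subsetSum m f) (subsetSum m g) _ _)
  where
  +-+-comm : ∀ a b c d → a + b + (c + d) ≡ a + c + (b + d)
  +-+-comm = solve-∀

subsetSum-*ʳ : ∀ m (f : ℕ → ℕ) K → subsetSum m (λ c → f c * K) ≡ subsetSum m f * K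
subsetSum-*ʳ zero f K = refl
subsetSum-*ʳ (suc m) f K =
  trans (cong₂ _+_ (subsetSum-*ʳ m f K) (subsetSum-*ʳ m (f ∘ suc) K)) (sym (*-distribʳ-+ K (subsetSum m f) _))

subsetSum-const : ∀ m K → subsetSum m (λ _ → K) ≡ 2 ^ m * K
subsetSum-const zero K = sym (+-identityʳ K)
subsetSum-const (suc m) K = trans (cong₂ _+_ (subsetSum-const m K) (subsetSum-const m K)) (double (2 ^ m) K)
  where
  double : ∀ a b → a * b + a * b ≡ 2 * a * b
  double = solve-∀

term≤subsetSum : ∀ m (f : ℕ → ℕ) {j} → j ≤ m → f j ≤ subsetSum m f
term≤subsetSum zero f z≤n = ≤-refl
term≤subsetSum (suc m) f {zero} _ = ≤-trans (term≤subsetSum m f z≤n) (m≤m+n _ _)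
term≤subsetSum (suc m) f {suc j} (s≤s j≤m) = ≤-trans (term≤subsetSum m (f ∘ suc) j≤m) (m≤n+m _ _)

^-distrib-* : ∀ a b e → (a * b) ^ e ≡ a ^ e * b ^ e
^-distrib-* a b zero = refl
^-distrib-* a b (suc e) = trans (cong (a * b *_) (^-distrib-* a b e)) (swap a b (a ^ e) (b ^ e))
  where
  swap : ∀ a b x y → a * b * (x * y) ≡ a * x * (b * y)
  swap = solve-∀

4[6d+12]2^d≤3^d : ∀ d → 16 ≤ d → 4 * (6 * d + 12) * 2 ^ d ≤ 3 ^ d
4[6d+12]2^d≤3^d d 16≤d = subst P (m+[n∸m]≡n 16≤d) (from16 (d ∸ 16))
  where
  P : ℕ → Set
  P d = 4 * (6 * d + 12) * 2 ^ d ≤ 3 ^ d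
  step : ∀ d → P d → P (suc d)
  step d Pd = begin
    4 * (6 * suc d + 12) * (2 * 2 ^ d) ≡⟨ e₁ d (2 ^ d) ⟩
    (12 * d + 36) * (4 * 2 ^ d) ≤⟨ *-monoˡ-≤ (4 * 2 ^ d) (+-monoˡ-≤ 36 (*-monoˡ-≤ d (≤ᵇ⇒≤ 12 18 _))) ⟩
    (18 * d + 36) * (4 * 2 ^ d) ≡⟨ e₂ d (2 ^ d) ⟩
    3 * (4 * (6 * d + 12) * 2 ^ d) ≤⟨ *-monoʳ-≤ 3 Pd ⟩
    3 * 3 ^ d ∎
    where
    open ≤-Reasoning
    e₁ : ∀ d x → 4 * (6 * suc d + 12) * (2 * x) ≡ (12 * d + 36) * (4 * x)
    e₁ = solve-∀
    e₂ : ∀ d x → (18 * d + 36) * (4 * x) ≡ 3 * (4 * (6 * d + 12) * x)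
    e₂ = solve-∀
  from16 : ∀ t → P (16 + t)
  from16 zero = ≤ᵇ⇒≤ (4 * (6 * 16 + 12) * 2 ^ 16) (3 ^ 16) _
  from16 (suc t) = subst P (sym (+-suc 16 t)) (step (16 + t) (from16 t))

-- Since 2^p − 1 ≥ (3/4)·2^p for p ≥ 2, the ratio of the two sides is governed by (3/2)^b.
term-bound : ∀ K T p b → 2 ≤ p → T ≤ K → 4 * p * K * 2 ^ b ≤ 3 ^ b * T →
  2 * (p * (2 ^ (p ∸ 1)) ^ b) * (K + T) ≤ (2 ^ p ∸ 1) ^ b * T
term-bound K T p@(suc p₁@(suc p₂)) b (s≤s (s≤s z≤n)) T≤K H = *-cancelʳ-≤ _ _ (4 ^ b) {{>-nonZero (m^n>0 4 b)}} (begin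
  2 * (p * P₁ ^ b) * (K + T) * 4 ^ b ≡⟨ e₁ p (P₁ ^ b) K T (4 ^ b) ⟩
  2 * p * (K + T) * (P₁ ^ b * 4 ^ b) ≡⟨ cong (2 * p * (K + T) *_) (^-distrib-* P₁ 4 b) ⟨
  2 * p * (K + T) * (P₁ * 4) ^ b ≡⟨ cong (λ z → 2 * p * (K + T) * z ^ b) (e₂ P₁) ⟩
  2 * p * (K + T) * (P * 2) ^ b ≡⟨ cong (2 * p * (K + T) *_) (^-distrib-* P 2 b) ⟩
  2 * p * (K + T) * (P ^ b * 2 ^ b) ≤⟨ *-monoˡ-≤ (P ^ b * 2 ^ b) (*-monoʳ-≤ (2 * p) (+-monoʳ-≤ K T≤K)) ⟩
  2 * p * (K + K) * (P ^ b * 2 ^ b) ≡⟨ e₃ p K (P ^ b) (2 ^ b) ⟩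
  P ^ b * (4 * p * K * 2 ^ b) ≤⟨ *-monoʳ-≤ (P ^ b) H ⟩
  P ^ b * (3 ^ b * T) ≡⟨ e₄ (P ^ b) (3 ^ b) T ⟩
  3 ^ b * P ^ b * T ≡⟨ cong (_* T) (^-distrib-* 3 P b) ⟨
  (3 * P) ^ b * T ≤⟨ *-monoˡ-≤ T (^-monoˡ-≤ b 3P≤4Q) ⟩
  (4 * Q) ^ b * T ≡⟨ cong (_* T) (^-distrib-* 4 Q b) ⟩
  4 ^ b * Q ^ b * T ≡⟨ e₅ (4 ^ b) (Q ^ b) T ⟩
  Q ^ b * T * 4 ^ b ∎)
  where
  open ≤-Reasoning
  P₁ = 2 ^ p₁
  P = 2 ^ p
  Q = P ∸ 1
  e₁ : ∀ p x K T y → 2 * (p * x) * (K + T) * y ≡ 2 * p * (K + T) * (x * y)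
  e₁ = solve-∀
  e₂ : ∀ x → x * 4 ≡ (2 * x) * 2
  e₂ = solve-∀
  e₃ : ∀ p K x y → 2 * p * (K + K) * (x * y) ≡ x * (4 * p * K * y)
  e₃ = solve-∀
  e₄ : ∀ a b c → a * (b * c) ≡ b * a * c
  e₄ = solve-∀
  e₅ : ∀ a b c → a * b * c ≡ b * c * a
  e₅ = solve-∀
  4≤P : 4 ≤ P
  4≤P = *-monoʳ-≤ 2 (*-monoʳ-≤ 2 (m^n>0 2 p₂))
  3P≤4Q : 3 * P ≤ 4 * Q
  3P≤4Q = +-cancelʳ-≤ 4 (3 * P) (4 * Q) (begin
    3 * P + 4 ≤⟨ +-monoʳ-≤ (3 * P) 4≤P ⟩
    3 * P + P ≡⟨ e P ⟩
    4 * P ≡⟨ cong (4 *_) (m∸n+n≡m (≤-trans (s≤s z≤n) 4≤P)) ⟨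
    4 * (Q + 1) ≡⟨ *-distribˡ-+ 4 Q 1 ⟩
    4 * Q + 4 ∎)
    where
    e : ∀ P → 3 * P + P ≡ 4 * P
    e = solve-∀

-- The hypotheses give (A − B)·3^k ≤ E·3^k ≤ B·2^k; cubing and n ≤ 3k give the conclusion,
-- which is A ≤ B (1 + (2/3)^(n/3)) with both sides cubed.
cube-bound : ∀ A B E n k → B ≤ A → A ≤ B + E → E * (3 ^ k + 2 ^ k) ≤ A * 2 ^ k → n ≤ 3 * k →
  (A ∸ B) ^ 3 * 3 ^ n ≤ B ^ 3 * 2 ^ n
cube-bound A B E n k B≤A A≤B+E EW n≤3k = *-cancelʳ-≤ _ _ (2 ^ n * 2 ^ s) {{nz}} (begin
  x ^ 3 * 3 ^ n * (2 ^ n * 2 ^ s) ≤⟨ *-monoʳ-≤ (x ^ 3 * 3 ^ n) (*-monoʳ-≤ (2 ^ n) (^-monoˡ-≤ s (≤ᵇ⇒≤ 2 3 _))) ⟩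
  x ^ 3 * 3 ^ n * (2 ^ n * 3 ^ s) ≡⟨ e₁ (x ^ 3) (3 ^ n) (2 ^ n) (3 ^ s) ⟩
  x ^ 3 * (3 ^ n * 3 ^ s) * 2 ^ n ≡⟨ cong (λ z → x ^ 3 * z * 2 ^ n) (trans (sym (^-distribˡ-+-* 3 n s)) (cong (3 ^_) ns)) ⟩
  x ^ 3 * 3 ^ (3 * k) * 2 ^ n ≡⟨ cong (λ z → x ^ 3 * z * 2 ^ n) (trans (cong (3 ^_) (*-comm 3 k)) (sym (^-*-assoc 3 k 3))) ⟩
  x ^ 3 * (3 ^ k) ^ 3 * 2 ^ n ≡⟨ cong (_* 2 ^ n) (^-distrib-* x (3 ^ k) 3) ⟨
  (x * 3 ^ k) ^ 3 * 2 ^ n ≤⟨ *-monoˡ-≤ (2 ^ n) (^-monoˡ-≤ 3 x3^k≤B2^k) ⟩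
  (B * 2 ^ k) ^ 3 * 2 ^ n ≡⟨ cong (_* 2 ^ n) (^-distrib-* B (2 ^ k) 3) ⟩
  B ^ 3 * (2 ^ k) ^ 3 * 2 ^ n ≡⟨ cong (λ z → B ^ 3 * z * 2 ^ n) (trans (^-*-assoc 2 k 3) (cong (2 ^_) (*-comm k 3))) ⟩
  B ^ 3 * 2 ^ (3 * k) * 2 ^ n ≡⟨ cong (λ z → B ^ 3 * z * 2 ^ n) (trans (cong (2 ^_) (sym ns)) (^-distribˡ-+-* 2 n s)) ⟩
  B ^ 3 * (2 ^ n * 2 ^ s) * 2 ^ n ≡⟨ e₂ (B ^ 3) (2 ^ n) (2 ^ s) ⟩
  B ^ 3 * 2 ^ n * (2 ^ n * 2 ^ s) ∎)
  where
  open ≤-Reasoning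
  x = A ∸ B
  s = 3 * k ∸ n
  ns : n + s ≡ 3 * k
  ns = m+[n∸m]≡n n≤3k
  nz : NonZero (2 ^ n * 2 ^ s)
  nz = >-nonZero (*-mono-≤ (m^n>0 2 n) (m^n>0 2 s))
  E3^k≤B2^k : E * 3 ^ k ≤ B * 2 ^ k
  E3^k≤B2^k = +-cancelʳ-≤ (E * 2 ^ k) (E * 3 ^ k) (B * 2 ^ k) (begin
    E * 3 ^ k + E * 2 ^ k ≡⟨ *-distribˡ-+ E (3 ^ k) (2 ^ k) ⟨
    E * (3 ^ k + 2 ^ k) ≤⟨ EW ⟩
    A * 2 ^ k ≤⟨ *-monoˡ-≤ (2 ^ k) A≤B+E ⟩
    (B + E) * 2 ^ k ≡⟨ *-distribʳ-+ (2 ^ k) B E ⟩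
    B * 2 ^ k + E * 2 ^ k ∎)
  x3^k≤B2^k : x * 3 ^ k ≤ B * 2 ^ k
  x3^k≤B2^k = ≤-trans (*-monoˡ-≤ (3 ^ k) (≤-trans (∸-monoˡ-≤ B A≤B+E) (≤-reflexive (m+n∸m≡n B E)))) E3^k≤B2^k
  e₁ : ∀ a b c d → a * b * (c * d) ≡ a * (b * d) * c
  e₁ = solve-∀
  e₂ : ∀ a b c → a * (b * c) * b ≡ a * b * (b * c)
  e₂ = solve-∀

-- k is chosen so that n ≤ 3k.
module LargeN (n : ℕ) (120≤n : 120 ≤ n) where

  m q k K T W : ℕ
  m = n ∸ 1
  q = half n
  k = n / 3 + 1
  K = 3 ^ k
  T = 2 ^ k
  W = K + T

  open ≤-Reasoning

  private

    n≡1+m : n ≡ suc m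
    n≡1+m = sym (m+[n∸m]≡n (≤-trans (s≤s z≤n) 120≤n))

    119≤m : 119 ≤ m
    119≤m = ∸-monoˡ-≤ 1 120≤n

    q≤n∸2 : q ≤ n ∸ 2
    q≤n∸2 = proj₂ (half-bounds n (≤-trans (≤ᵇ⇒≤ 5 120 _) 120≤n))

    2q≤m : q * 2 ≤ m
    2q≤m = m/n*n≤m m 2

    n≤2q+2 : n ≤ q * 2 + 2
    n≤2q+2 = begin
      n ≡⟨ n≡1+m ⟩
      suc m ≡⟨ cong suc (m≡m%n+[m/n]*n m 2) ⟩
      suc (m % 2 + q * 2) ≤⟨ s≤s (+-monoˡ-≤ (q * 2) (≤-pred (m%n<n m 2))) ⟩
      suc (1 + q * 2) ≡⟨ +-comm 2 (q * 2) ⟩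
      q * 2 + 2 ∎

    3k≤n+3 : 3 * k ≤ n + 3
    3k≤n+3 = begin
      3 * (n / 3 + 1) ≡⟨ e (n / 3) ⟩
      n / 3 * 3 + 3 ≤⟨ +-monoˡ-≤ 3 (m/n*n≤m n 3) ⟩
      n + 3 ∎
      where
      e : ∀ x → 3 * (x + 1) ≡ x * 3 + 3
      e = solve-∀

    k≤q : k ≤ q
    k≤q = *-cancelˡ-≤ 6 (+-cancelʳ-≤ 6 (6 * k) (6 * q) (begin
      6 * k + 6 ≡⟨ e₁ k ⟩
      2 * (3 * k) + 6 ≤⟨ +-monoˡ-≤ 6 (*-monoʳ-≤ 2 3k≤n+3) ⟩
      2 * (n + 3) + 6 ≡⟨ e₂ n ⟩
      2 * n + 12 ≤⟨ +-monoʳ-≤ (2 * n) (≤-trans (≤ᵇ⇒≤ 12 120 _) 120≤n) ⟩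
      2 * n + n ≡⟨ e₃ n ⟩
      3 * n ≤⟨ *-monoʳ-≤ 3 n≤2q+2 ⟩
      3 * (q * 2 + 2) ≡⟨ e₄ q ⟩
      6 * q + 6 ∎))
      where
      e₁ : ∀ x → 6 * x + 6 ≡ 2 * (3 * x) + 6
      e₁ = solve-∀
      e₂ : ∀ x → 2 * (x + 3) + 6 ≡ 2 * x + 12
      e₂ = solve-∀
      e₃ : ∀ x → 2 * x + x ≡ 3 * x
      e₃ = solve-∀
      e₄ : ∀ x → 3 * (x * 2 + 2) ≡ 6 * x + 6
      e₄ = solve-∀

    d = q ∸ k

    k+d≡q : k + d ≡ q
    k+d≡q = m+[n∸m]≡n k≤q

    n≤6d+12 : n ≤ 6 * d + 12
    n≤6d+12 = +-cancelˡ-≤ (2 * n) n (6 * d + 12) (begin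
      2 * n + n ≡⟨ e₁ n ⟩
      3 * n ≤⟨ *-monoʳ-≤ 3 n≤2q+2 ⟩
      3 * (q * 2 + 2) ≡⟨ cong (λ z → 3 * (z * 2 + 2)) k+d≡q ⟨
      3 * ((k + d) * 2 + 2) ≡⟨ e₂ k d ⟩
      2 * (3 * k) + (6 * d + 6) ≤⟨ +-monoˡ-≤ (6 * d + 6) (*-monoʳ-≤ 2 3k≤n+3) ⟩
      2 * (n + 3) + (6 * d + 6) ≡⟨ e₃ n d ⟩
      2 * n + (6 * d + 12) ∎)
      where
      e₁ : ∀ x → 2 * x + x ≡ 3 * x
      e₁ = solve-∀
      e₂ : ∀ k d → 3 * ((k + d) * 2 + 2) ≡ 2 * (3 * k) + (6 * d + 6)
      e₂ = solve-∀
      e₃ : ∀ n d → 2 * (n + 3) + (6 * d + 6) ≡ 2 * n + (6 * d + 12)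
      e₃ = solve-∀

    16≤d : 16 ≤ d
    16≤d = *-cancelˡ-≤ 6 (+-cancelʳ-≤ 12 (6 * 16) (6 * d) (≤-trans (≤ᵇ⇒≤ (6 * 16 + 12) 120 _) (≤-trans 120≤n n≤6d+12)))

    2≤q : 2 ≤ q
    2≤q = *-cancelʳ-≤ 2 q 2 (+-cancelʳ-≤ 2 (2 * 2) (q * 2) (≤-trans (≤ᵇ⇒≤ 6 120 _) (≤-trans 120≤n n≤2q+2)))

    T≤K : T ≤ K
    T≤K = ^-monoˡ-≤ k (s≤s (s≤s z≤n))

    -- With q = k + d this is 4n·2^d ≤ 3^d, true as n ≤ 6d + 12 and d ≥ 16.
    growth-at-q : 4 * n * K * 2 ^ q ≤ 3 ^ q * T
    growth-at-q = begin
      4 * n * K * 2 ^ q ≡⟨ cong (λ z → 4 * n * K * 2 ^ z) k+d≡q ⟨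
      4 * n * K * 2 ^ (k + d) ≡⟨ cong (4 * n * K *_) (^-distribˡ-+-* 2 k d) ⟩
      4 * n * K * (T * 2 ^ d) ≡⟨ e₁ n K T (2 ^ d) ⟩
      4 * n * 2 ^ d * (K * T) ≤⟨ *-monoˡ-≤ (K * T) (*-monoˡ-≤ (2 ^ d) (*-monoʳ-≤ 4 n≤6d+12)) ⟩
      4 * (6 * d + 12) * 2 ^ d * (K * T) ≤⟨ *-monoˡ-≤ (K * T) (4[6d+12]2^d≤3^d d 16≤d) ⟩
      3 ^ d * (K * T) ≡⟨ e₂ (3 ^ d) K T ⟩
      K * 3 ^ d * T ≡⟨ cong (_* T) (^-distribˡ-+-* 3 k d) ⟨
      3 ^ (k + d) * T ≡⟨ cong (λ z → 3 ^ z * T) k+d≡q ⟩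
      3 ^ q * T ∎
      where
      e₁ : ∀ n K T x → 4 * n * K * (T * x) ≡ 4 * n * x * (K * T)
      e₁ = solve-∀
      e₂ : ∀ x K T → x * (K * T) ≡ K * x * T
      e₂ = solve-∀

    growth : ∀ p b → p ≤ n → q ≤ b → 4 * p * K * 2 ^ b ≤ 3 ^ b * T
    growth p b p≤n q≤b = ≤-trans (*-monoˡ-≤ (2 ^ b) (*-monoˡ-≤ K (*-monoʳ-≤ 4 p≤n)))
      (subst (λ z → 4 * n * K * 2 ^ z ≤ 3 ^ z * T) (m+[n∸m]≡n q≤b) (from-q (b ∸ q)))
      where
      from-q : ∀ t → 4 * n * K * 2 ^ (q + t) ≤ 3 ^ (q + t) * T
      from-q zero = subst (λ z → 4 * n * K * 2 ^ z ≤ 3 ^ z * T) (sym (+-identityʳ q)) growth-at-q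
      from-q (suc t) = subst (λ z → 4 * n * K * 2 ^ z ≤ 3 ^ z * T) (sym (+-suc q t)) (begin
        4 * n * K * (2 * 2 ^ (q + t)) ≡⟨ e (4 * n * K) (2 ^ (q + t)) ⟩
        2 * (4 * n * K * 2 ^ (q + t)) ≤⟨ *-monoʳ-≤ 2 (from-q t) ⟩
        2 * (3 ^ (q + t) * T) ≤⟨ *-monoˡ-≤ (3 ^ (q + t) * T) (≤ᵇ⇒≤ 2 3 _) ⟩
        3 * (3 ^ (q + t) * T) ≡⟨ *-assoc 3 (3 ^ (q + t)) T ⟨
        3 * 3 ^ (q + t) * T ∎)
        where
        e : ∀ a x → a * (2 * x) ≡ 2 * (a * x)
        e = solve-∀

    q≤n∸c∸1 : ∀ {c} → c ≤ q → q ≤ n ∸ c ∸ 1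
    q≤n∸c∸1 {c} c≤q = ≤-trans q≤n∸q∸1 (∸-monoˡ-≤ 1 (∸-monoʳ-≤ n c≤q))
      where
      q≤n∸q∸1 : q ≤ n ∸ q ∸ 1
      q≤n∸q∸1 = begin
        q ≡⟨ m+n∸n≡m q (q + 1) ⟨
        q + (q + 1) ∸ (q + 1) ≤⟨ ∸-monoˡ-≤ (q + 1) (≤-trans (≤-reflexive (e q)) (≤-trans (s≤s 2q≤m) (≤-reflexive (sym n≡1+m)))) ⟩
        n ∸ (q + 1) ≡⟨ ∸-+-assoc n q 1 ⟨
        n ∸ q ∸ 1 ∎
        where
        e : ∀ q → q + (q + 1) ≡ suc (q * 2)
        e = solve-∀

    module U = PiecewiseCases n (upper₁ n) (upper₂ n)
    module S = PiecewiseCases n (slack₁ n) (slack₂ n)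

    double : ∀ e → e * (2 * W) ≡ 2 * e * W
    double e = solve e W
      where
      solve : ∀ e W → e * (2 * W) ≡ 2 * e * W
      solve = solve-∀

  private
    low-term : ∀ {c} → 2 ≤ c → c ≤ q → slack n c * (2 * W) ≤ upper n c * T
    low-term {c} 2≤c c≤q = begin
      slack n c * (2 * W) ≡⟨ cong (_* (2 * W)) (S.piecewise-low {c} 2≤c c≤q q≤n∸2) ⟩
      slack₁ n c * (2 * W) ≡⟨ double (slack₁ n c) ⟩
      2 * slack₁ n c * W ≤⟨ term-bound K T c (n ∸ c ∸ 1) 2≤c T≤K (growth c (n ∸ c ∸ 1) c≤n (q≤n∸c∸1 c≤q)) ⟩
      upper₁ n c * T ≡⟨ cong (_* T) (U.piecewise-low {c} 2≤c c≤q q≤n∸2) ⟨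
      upper n c * T ∎
      where c≤n = ≤-trans c≤q (≤-trans q≤n∸2 (m∸n≤m n 2))

    high-term : ∀ {c} → 2 ≤ c → q < c → c < n ∸ 2 → slack n c * (2 * W) ≤ upper n c * T
    high-term {c} 2≤c q<c c<n∸2 = begin
      slack n c * (2 * W) ≡⟨ cong (_* (2 * W)) (S.piecewise-high {c} 2≤c q<c (<⇒≤ c<n∸2)) ⟩
      slack₂ n c * (2 * W) ≡⟨ double (slack₂ n c) ⟩
      2 * slack₂ n c * W ≤⟨ term-bound K T (n ∸ c ∸ 1) c 2≤n∸c∸1 T≤K (growth (n ∸ c ∸ 1) c (≤-trans (m∸n≤m (n ∸ c) 1) (m∸n≤m n c)) (<⇒≤ q<c)) ⟩
      upper₂ n c * T ≡⟨ cong (_* T) (U.piecewise-high {c} 2≤c q<c (<⇒≤ c<n∸2)) ⟨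
      upper n c * T ∎
      where
      3+c≤n : 3 + c ≤ n
      3+c≤n = ≤-trans (+-monoʳ-≤ 2 c<n∸2) (≤-reflexive (m+[n∸m]≡n (≤-trans (≤ᵇ⇒≤ 2 120 _) 120≤n)))
      2≤n∸c∸1 : 2 ≤ n ∸ c ∸ 1
      2≤n∸c∸1 = m+n≤o⇒m≤o∸n 2 (m+n≤o⇒m≤o∸n 3 3+c≤n)

    slack-at-n∸2 : q < n ∸ 2 → slack n (n ∸ 2) ≡ 1
    slack-at-n∸2 q<n∸2 =
      trans (S.piecewise-high {n ∸ 2} 2≤n∸2 q<n∸2 ≤-refl)
        (trans (cong (λ i → i * (2 ^ (i ∸ 1)) ^ (n ∸ 2)) n∸[n∸2]∸1≡1) (trans (+-identityʳ _) (^-zeroˡ (n ∸ 2))))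
      where
      2≤n∸2 = ≤-trans (≤ᵇ⇒≤ 2 118 _) (∸-monoˡ-≤ 2 120≤n)
      n∸[n∸2]∸1≡1 : n ∸ (n ∸ 2) ∸ 1 ≡ 1
      n∸[n∸2]∸1≡1 = cong (_∸ 1) (m∸[m∸n]≡n (≤-trans (≤ᵇ⇒≤ 2 120 _) 120≤n))

  -- Each term of the slack is small against the corresponding upper term, except at
  -- c = n − 2 where both equal 1; the extra W·2 absorbs that term.
  slack-term : ∀ c → slack n c * (2 * W) ≤ upper n c * T + W * 2
  slack-term c with c <? 2 | c ≤? q | c <? n ∸ 2 | c ≤? n ∸ 2
  ... | yes c<2 | _ | _ | _ rewrite S.piecewise-<2 c<2 = z≤n
  ... | no c≮2 | yes c≤q | _ | _ = ≤-trans (low-term (≮⇒≥ c≮2) c≤q) (m≤m+n _ _)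
  ... | no c≮2 | no c≰q | yes c<n∸2 | _ = ≤-trans (high-term (≮⇒≥ c≮2) (≰⇒> c≰q) c<n∸2) (m≤m+n _ _)
  ... | no _ | no c≰q | no c≮n∸2 | yes c≤n∸2 = begin
    slack n c * (2 * W) ≡⟨ cong (λ i → slack n i * (2 * W)) (≤-antisym c≤n∸2 (≮⇒≥ c≮n∸2)) ⟩
    slack n (n ∸ 2) * (2 * W) ≡⟨ cong (_* (2 * W)) (slack-at-n∸2 (≤-trans (≰⇒> c≰q) c≤n∸2)) ⟩
    1 * (2 * W) ≡⟨ e W ⟩
    W * 2 ≤⟨ m≤n+m _ _ ⟩
    upper n c * T + W * 2 ∎
    where
    e : ∀ W → 1 * (2 * W) ≡ W * 2
    e = solve-∀
  ... | no _ | _ | _ | no c≰n∸2 rewrite S.piecewise->n∸2 (≰⇒> c≰n∸2) = z≤n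

  boundary-term : 2 ^ m * W * 2 ≤ subsetSum m (upper n) * T
  boundary-term = begin
    2 ^ m * W * 2 ≤⟨ *-monoˡ-≤ 2 (*-monoʳ-≤ (2 ^ m) (+-monoʳ-≤ K T≤K)) ⟩
    2 ^ m * (K + K) * 2 ≡⟨ cong (λ z → 2 ^ z * (K + K) * 2) m≡2+r ⟩
    2 ^ (2 + r) * (K + K) * 2 ≡⟨ e (2 ^ r) K ⟩
    16 * K * 2 ^ r ≤⟨ *-monoˡ-≤ (2 ^ r) (*-monoˡ-≤ K (≤-trans (≤ᵇ⇒≤ 16 480 _) (*-monoʳ-≤ 4 120≤n))) ⟩
    4 * n * K * 2 ^ r ≤⟨ growth n r ≤-refl (q≤n∸c∸1 2≤q) ⟩
    3 ^ r * T ≡⟨ cong (_* T) (U.piecewise-low {2} ≤-refl 2≤q q≤n∸2) ⟨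
    upper n 2 * T ≤⟨ *-monoˡ-≤ T (term≤subsetSum m (upper n) (≤-trans (≤ᵇ⇒≤ 2 119 _) 119≤m)) ⟩
    subsetSum m (upper n) * T ∎
    where
    r = n ∸ 2 ∸ 1
    m≡2+r : m ≡ 2 + r
    m≡2+r = n∸1≡2+[n∸2∸1] n (≤-trans (≤ᵇ⇒≤ 3 120 _) 120≤n)
      where
      n∸1≡2+[n∸2∸1] : ∀ n → 3 ≤ n → n ∸ 1 ≡ 2 + (n ∸ 2 ∸ 1)
      n∸1≡2+[n∸2∸1] (suc (suc (suc _))) (s≤s (s≤s (s≤s z≤n))) = refl
    e : ∀ x K → 2 * (2 * x) * (K + K) * 2 ≡ 16 * K * x
    e = solve-∀

  slack≤upper : subsetSum m (slack n) * W ≤ subsetSum m (upper n) * T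
  slack≤upper = *-cancelʳ-≤ _ _ 2 (begin
    subsetSum m (slack n) * W * 2 ≡⟨ e₁ (subsetSum m (slack n)) W ⟩
    subsetSum m (slack n) * (2 * W) ≡⟨ subsetSum-*ʳ m (slack n) (2 * W) ⟨
    subsetSum m (λ c → slack n c * (2 * W)) ≤⟨ subsetSum-mono m slack-term ⟩
    subsetSum m (λ c → upper n c * T + W * 2) ≡⟨ subsetSum-+ m (λ c → upper n c * T) (λ _ → W * 2) ⟩
    subsetSum m (λ c → upper n c * T) + subsetSum m (λ _ → W * 2)
      ≡⟨ cong₂ _+_ (subsetSum-*ʳ m (upper n) T) (trans (subsetSum-const m (W * 2)) (sym (*-assoc (2 ^ m) W 2))) ⟩
    subsetSum m (upper n) * T + 2 ^ m * W * 2 ≤⟨ +-monoʳ-≤ _ boundary-term ⟩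
    subsetSum m (upper n) * T + subsetSum m (upper n) * T ≡⟨ e₂ (subsetSum m (upper n) * T) ⟩
    subsetSum m (upper n) * T * 2 ∎)
    where
    e₁ : ∀ a W → a * W * 2 ≡ a * (2 * W)
    e₁ = solve-∀
    e₂ : ∀ a → a + a ≡ a * 2
    e₂ = solve-∀

  n*slack≤n*upper : n * subsetSum m (slack n) * W ≤ n * subsetSum m (upper n) * T
  n*slack≤n*upper = begin
    n * subsetSum m (slack n) * W ≡⟨ *-assoc n (subsetSum m (slack n)) W ⟩
    n * (subsetSum m (slack n) * W) ≤⟨ *-monoʳ-≤ n slack≤upper ⟩
    n * (subsetSum m (upper n) * T) ≡⟨ *-assoc n (subsetSum m (upper n)) T ⟨
    n * subsetSum m (upper n) * T ∎

  n≤3k : n ≤ 3 * k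
  n≤3k = begin
    n ≡⟨ m≡m%n+[m/n]*n n 3 ⟩
    n % 3 + n / 3 * 3 ≤⟨ +-monoˡ-≤ (n / 3 * 3) (≤-trans (≤-pred (m%n<n n 3)) (n≤1+n 2)) ⟩
    3 + n / 3 * 3 ≡⟨ e (n / 3) ⟩
    3 * (n / 3 + 1) ∎
    where
    e : ∀ x → 3 + x * 3 ≡ 3 * (x + 1)
    e = solve-∀

lemma7p11 : ∃ λ (N : ℕ) → ∀ (n : ℕ) → N ≤ n →
    ∀ (L : List (AdjMatrix n)) → Unique L →
    (∀ (M : AdjMatrix n) → (M ∈ L) ⇔ IsSplitQ1 M) →
    IsApprox n (approxSum n) (length L)
lemma7p11 = 120 , approximation
  where
  approximation : ∀ n → 120 ≤ n → ∀ (L : List (AdjMatrix n)) → Unique L →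
    (∀ M → (M ∈ L) ⇔ IsSplitQ1 M) → IsApprox n (approxSum n) (length L)
  approximation n@(suc (suc _)) 120≤n@(s≤s (s≤s _)) L unique-L L≡Q1
    rewrite approxSum≡ n (≤-trans (≤ᵇ⇒≤ 5 120 _) 120≤n) =
    L≤U , cube-bound U (length L) E n k L≤U U≤L+E n*slack≤n*upper n≤3k
    where
    open LargeN n 120≤n using (m; k; n*slack≤n*upper; n≤3k)
    U = n * subsetSum m (upper n)
    E = n * subsetSum m (slack n)
    L≤U = length≤upper L unique-L (Equivalence.to (L≡Q1 _))
    U≤L+E = upper≤length+slack L (Equivalence.from (L≡Q1 _))
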